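{- Let $\mathcal{J}$ be a symmetric matrix of nonnegative integers with finitely many nonzero entries satisfying: $\mathcal{D}_k=\frac1k(\mathcal{J}_{k,k}+\sum_{l}\mathcal{J}_{k,l})$ is an integer for every $k$, $\mathcal{J}_{k,l}\le\mathcal{D}_k\mathcal{D}_l$ for all $k\ne l$, and $\mathcal{J}_{k,k}\le\binom{\mathcal{D}_k}{2}$ for all $k$. Then Algorithm 1 (described in the context) can always be carried out to completion, and it produces a simple graph $G$ with $\mathcal{J}(G)=\mathcal{J}$.
   Context: For a graph $G$, $\mathcal{J}(G)_{k,l}$ is the number of edges between a vertex of degree $k$ and a vertex of degree $l$. Given $\mathcal{J}$, fix a vertex set consisting of $\mathcal{D}_k$ vertices of target degree $k$ for each $k$; the residual degree of a vertex is its target degree minus the number of edges currently incident to it. Algorithm 1 starts from the empty graph $G$ on this vertex set and processes the pairs $(k,l)$ with $k\ge l$ in order of decreasing $k$ and, for fixed $k$, decreasing $l$. For a pair with $k\neq l$: let $a=\mathcal{J}_{k,l}\bmod \mathcal{D}_k$ and $b=\mathcal{J}_{k,l}\bmod\mathcal{D}_l$; construct a simple bipartite graph $B$ with one side of $\mathcal{D}_k$ vertices having degrees $x_1=\dots=x_a=\lfloor \mathcal{J}_{k,l}/\mathcal{D}_k\rfloor+1$, $x_{a+1}=\dots=x_{\mathcal{D}_k}=\lfloor \mathcal{J}_{k,l}/\mathcal{D}_k\rfloor$, and the other side of $\mathcal{D}_l$ vertices having degrees $y_1=\dots=y_b=\lfloor \mathcal{J}_{k,l}/\mathcal{D}_l\rfloor+1$,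 $y_{b+1}=\dots=y_{\mathcal{D}_l}=\lfloor\mathcal{J}_{k,l}/\mathcal{D}_l\rfloor$. For $k=l$: let $c=2\mathcal{J}_{k,k}\bmod\mathcal{D}_k$ and construct a simple graph $B$ on $\mathcal{D}_k$ vertices with degrees $x_1=\dots=x_c=\lfloor 2\mathcal{J}_{k,k}/\mathcal{D}_k\rfloor+1$, $x_{c+1}=\dots=x_{\mathcal{D}_k}=\lfloor 2\mathcal{J}_{k,k}/\mathcal{D}_k\rfloor$. Then $B$ is placed into $G$ by identifying the vertices of $B$ on the degree-$k$ side (resp. degree-$l$ side) bijectively with the target-degree-$k$ (resp. $l$) vertices of $G$, where the vertices of $B$ with the larger degrees ($x_1,\dots,x_a$, resp. $y_1,\dots,y_b$) are matched to vertices of $G$ with higher residual degree, the rest arbitrarily; the edges of $B$ are added to $G$ and residual degrees are updated. -}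

module Defs where

open import Data.Nat using (ℕ; zero; suc; _+_; _*_; _∸_; _≤_; _<_; _/_; _%_; _≟_; _<?_)
open import Data.Nat.Divisibility using (_∣_)
open import Data.Nat.Combinatorics using (_C_)
open import Data.Integer as ℤ using (ℤ; +_)
open import Data.Fin using (Fin; zero; suc; toℕ)
open import Data.Bool using (Bool; true; false; if_then_else_; _∧_; _∨_)
open import Data.Nat.ListAction using (sum)
open import Data.List using (List; []; _∷_; map; upTo; downFrom; concatMap; _++_)
open import Data.Product using (Σ; ∃; _×_; _,_)
open import Data.Sum using (_⊎_)
open import Relation.Nullary using (¬_)
open import Relation.Nullary.Decidable using (⌊_⌋)
open import Relation.Binary.PropositionalEquality using (_≡_; _≢_)
open import Function.Definitions using (Injective)
open import Function.Bundles using (_⇔_)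

countF : ∀ {m} → (Fin m → Bool) → ℕ
countF {zero}  f = 0
countF {suc m} f = (if f zero then 1 else 0) + countF (λ i → f (suc i))

sumF : ∀ {m} → (Fin m → ℕ) → ℕ
sumF {zero}  f = 0
sumF {suc m} f = f zero + sumF (λ i → f (suc i))

range1 : ℕ → List ℕ
range1 N = map suc (upTo N)

range1↓ : ℕ → List ℕ
range1↓ N = map suc (downFrom N)

-- Joint degree matrices (degrees indexed by ℕ; meaningful indices are 1..N)

Matrix : Set
Matrix = ℕ → ℕ → ℕ

rowSum : Matrix → ℕ → ℕ → ℕ
rowSum J N k = sum (map (J k) (range1 N))

-- D_k = (J_{k,k} + Σ_l J_{k,l}) / k   (D_0 := 0; only used for k ≥ 1)
D : Matrix → ℕ → ℕ → ℕ
D J N zero    = 0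
D J N (suc k) = (J (suc k) (suc k) + rowSum J N (suc k)) / suc k

-- total division / remainder (value for divisor 0 is irrelevant: then the side is empty)
_div′_ : ℕ → ℕ → ℕ
m div′ zero  = 0
m div′ suc d = m / suc d

_mod′_ : ℕ → ℕ → ℕ
m mod′ zero  = 0
m mod′ suc d = m % suc d

degSeq : (m d : ℕ) → Fin d → ℕ
degSeq m d i = m div′ d + (if ⌊ toℕ i <? m mod′ d ⌋ then 1 else 0)

pairs : ℕ → List (ℕ × ℕ)
pairs N = concatMap (λ k → map (λ l → (k , l)) (range1↓ k)) (range1↓ N)

Graph : ℕ → Set
Graph n = Fin n → Fin n → Bool

emptyGraph : ∀ {n} → Graph n
emptyGraph u v = false

Simple : ∀ {n} → Graph n → Set
Simple {n} G = (∀ u v → G u v ≡ G v u) × (∀ u → G u u ≡ false)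

deg : ∀ {n} → Graph n → Fin n → ℕ
deg G v = countF (G v)

JG : ∀ {n} → Graph n → ℕ → ℕ → ℕ
JG G k l = sumF (λ u → countF (λ v →
  ⌊ toℕ u <? toℕ v ⌋ ∧ G u v ∧
  ((⌊ deg G u ≟ k ⌋ ∧ ⌊ deg G v ≟ l ⌋) ∨ (⌊ deg G u ≟ l ⌋ ∧ ⌊ deg G v ≟ k ⌋))))

residual : ∀ {n} → (Fin n → ℕ) → Graph n → Fin n → ℤ
residual tdeg G v = + tdeg v ℤ.- + deg G v

ClassBij : ∀ {n} → (Fin n → ℕ) → (k d : ℕ) → (Fin d → Fin n) → Set
ClassBij tdeg k d σ =
  Injective _≡_ _≡_ σ × (∀ i → tdeg (σ i) ≡ k) × (∀ v → tdeg v ≡ k → ∃ λ i → σ i ≡ v)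

-- the vertices of B with the larger degree (indices < a) are matched to
-- vertices with higher (or equal) residual degree than the others
ResidualOrdered : ∀ {n} → (Fin n → ℕ) → Graph n → (a d : ℕ) → (Fin d → Fin n) → Set
ResidualOrdered tdeg G a d σ =
  ∀ i i' → toℕ i < a → a ≤ toℕ i' → residual tdeg G (σ i') ℤ.≤ residual tdeg G (σ i)

record OffDiagStep {n} (J : Matrix) (N : ℕ) (tdeg : Fin n → ℕ) (k l : ℕ)
                   (G G' : Graph n) : Set where
  field
    B      : Fin (D J N k) → Fin (D J N l) → Bool
    rowDeg : ∀ i → countF (B i) ≡ degSeq (J k l) (D J N k) i
    colDeg : ∀ j → countF (λ i → B i j) ≡ degSeq (J k l) (D J N l) j
    σ      : Fin (D J N k) → Fin n
    τ      : Fin (D J N l) → Fin n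
    σ-bij  : ClassBij tdeg k (D J N k) σ
    τ-bij  : ClassBij tdeg l (D J N l) τ
    σ-ord  : ResidualOrdered tdeg G (J k l mod′ D J N k) (D J N k) σ
    τ-ord  : ResidualOrdered tdeg G (J k l mod′ D J N l) (D J N l) τ
    result : ∀ u v → (G' u v ≡ true) ⇔
               (G u v ≡ true ⊎
                (∃ λ i → ∃ λ j → B i j ≡ true ×
                   ((σ i ≡ u × τ j ≡ v) ⊎ (σ i ≡ v × τ j ≡ u))))

record DiagStep {n} (J : Matrix) (N : ℕ) (tdeg : Fin n → ℕ) (k : ℕ)
                (G G' : Graph n) : Set where
  field
    B      : Fin (D J N k) → Fin (D J N k) → Bool
    B-sym  : ∀ i j → B i j ≡ B j i
    B-irr  : ∀ i → B i i ≡ false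
    degB   : ∀ i → countF (B i) ≡ degSeq (2 * J k k) (D J N k) i
    σ      : Fin (D J N k) → Fin n
    σ-bij  : ClassBij tdeg k (D J N k) σ
    σ-ord  : ResidualOrdered tdeg G ((2 * J k k) mod′ D J N k) (D J N k) σ
    result : ∀ u v → (G' u v ≡ true) ⇔
               (G u v ≡ true ⊎
                (∃ λ i → ∃ λ j → B i j ≡ true × σ i ≡ u × σ j ≡ v))

Step : ∀ {n} → Matrix → ℕ → (Fin n → ℕ) → ℕ × ℕ → Graph n → Graph n → Set
Step J N tdeg (k , l) G G' with k ≟ l
... | Relation.Nullary.yes _ = DiagStep J N tdeg k G G'
... | Relation.Nullary.no  _ = OffDiagStep J N tdeg k l G G'

data Run {n} (J : Matrix) (N : ℕ) (tdeg : Fin n → ℕ) :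
         Graph n → List (ℕ × ℕ) → Graph n → Set where
  done : ∀ {G} → Run J N tdeg G [] G
  step : ∀ {G G' G'' p ps} → Step J N tdeg p G G' → Run J N tdeg G' ps G'' →
         Run J N tdeg G (p ∷ ps) G''

module Submission where

-- Part 1, that every step can be carried out, needs only existence results:
-- a bipartite graph (Gale–Ryser in the near-regular case, built cyclically) or
-- a simple graph (built by peeling off a hub vertex) with near-regular degree
-- sequence degSeq, whose size is allowed by the bounds on J; and, for each
-- degree class, a listing sorted by current degree, which matches larger
-- entries of B with larger residual degrees.
--
-- Part 2, correctness of the output, follows from an invariant of runs: after
-- processing a list of pairs the graph is simple, has exactly J a b arcs from
-- class a to class b for each processed occurrence of (a, b) or (b, a), and
-- its degrees within each class differ by at most one.  At the end every pair
-- has been processed once, so the degrees in class k sum to k·D_k; balanced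
-- degrees with that average all equal k, and then J(G) = J.

open import Defs
open import Data.Nat using (ℕ; zero; suc; _+_; _*_; _∸_; _≤_; _<_; z≤n; s≤s; _≤?_; _<?_; _/_; _%_)
open import Data.Nat.Properties
open import Data.Nat.Divisibility using (_∣_)
open import Data.Nat.Combinatorics using (_C_; nC1≡n; nCk+nC[k+1]≡[n+1]C[k+1])
open import Data.Nat.Tactic.RingSolver using (solve-∀)
open import Data.Nat.DivMod using (m≡m%n+[m/n]*n; [m+kn]%n≡m%n; m<n⇒m%n≡m; m%n<n; m*[n/m]≡n)
open import Algebra.Properties.CommutativeSemigroup +-commutativeSemigroup using (interchange; x∙yz≈y∙xz)
open import Data.Fin using (Fin; zero; suc; toℕ; fromℕ<)
import Data.Integer as ℤ
import Data.Integer.Properties as ℤP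
open import Data.Fin.Properties using (any?; toℕ<n; toℕ-injective; toℕ-fromℕ<) renaming (_≟_ to _≟ᶠ_)
open import Data.Bool using (Bool; true; false; if_then_else_; _∧_; _∨_; not)
open import Data.Bool.Properties using (∧-comm; ∨-comm; ∧-zeroʳ; ∨-idem) renaming (_≟_ to _≟ᵇ_)
open import Data.Product using (Σ; ∃; _×_; _,_; proj₁; proj₂)
open import Data.Product.Properties using (,-injectiveˡ; ,-injectiveʳ) renaming (≡-dec to ×-≡-dec)
open import Data.List using (List; []; _∷_; _++_; _∷ʳ_; upTo; map)
open import Data.List.Properties using (++-assoc; ++-identityʳ; upTo-∷ʳ; map-++)
open import Data.Nat.ListAction using (sum)
open import Data.Nat.ListAction.Properties using (sum-++)
open import Data.Sum using (_⊎_; inj₁; inj₂; [_,_])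
open import Data.Empty using (⊥; ⊥-elim)
open import Relation.Nullary using (Dec; yes; no; ¬_)
open import Relation.Nullary.Decidable using (⌊_⌋; _×-dec_)
open import Relation.Binary.PropositionalEquality hiding ([_])
open import Relation.Binary using (Tri; tri<; tri≈; tri>)
open import Function using (_∘_)
open import Function.Definitions using (Injective)
open import Function.Bundles using (_⇔_; mk⇔; Equivalence)
open import Function.Construct.Identity using (⇔-id)

⟦_⟧ : Bool → ℕ
⟦ b ⟧ = if b then 1 else 0

dec-true : ∀ {a} {A : Set a} (a? : Dec A) → A → ⌊ a? ⌋ ≡ true
dec-true (yes _) _ = refl
dec-true (no ¬a) a = ⊥-elim (¬a a)

dec-false : ∀ {a} {A : Set a} (a? : Dec A) → ¬ A → ⌊ a? ⌋ ≡ false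
dec-false (no _)  _  = refl
dec-false (yes a) ¬a = ⊥-elim (¬a a)

witness : ∀ {a} {A : Set a} (a? : Dec A) → ⌊ a? ⌋ ≡ true → A
witness (yes a) _ = a

true≢false : true ≢ false
true≢false ()

∧-true : ∀ {a b} → a ∧ b ≡ true → a ≡ true × b ≡ true
∧-true {true} {true} _ = refl , refl

∨-true : ∀ {a b} → a ∨ b ≡ true → a ≡ true ⊎ b ≡ true
∨-true {true}  _ = inj₁ refl
∨-true {false} b = inj₂ b

notTrue : ∀ {b} → b ≢ true → b ≡ false
notTrue {true}  b≢true = ⊥-elim (b≢true refl)
notTrue {false} _      = refl

bool-ext : ∀ {a b} → (a ≡ true → b ≡ true) → (b ≡ true → a ≡ true) → a ≡ b
bool-ext {true}  a⇒b _   = sym (a⇒b refl)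
bool-ext {false} {true}  _ b⇒a = b⇒a refl
bool-ext {false} {false} _ _   = refl

⟦∧⟧ : ∀ a b → ⟦ a ∧ b ⟧ ≡ ⟦ a ⟧ * ⟦ b ⟧
⟦∧⟧ true  b = sym (+-identityʳ _)
⟦∧⟧ false b = refl

⟦∨⟧ : ∀ a b → (a ≡ true → b ≡ false) → ⟦ a ∨ b ⟧ ≡ ⟦ a ⟧ + ⟦ b ⟧
⟦∨⟧ true  b disjoint rewrite disjoint refl = refl
⟦∨⟧ false b _ = refl

⟦⟧≤1 : ∀ b → ⟦ b ⟧ ≤ 1
⟦⟧≤1 true  = ≤-refl
⟦⟧≤1 false = z≤n

∨-⇔ : ∀ {a b} {A B : Set} → (a ≡ true) ⇔ A → (b ≡ true) ⇔ B → (a ∨ b ≡ true) ⇔ (A ⊎ B)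
∨-⇔ {true}  a⇔A _   = mk⇔ (λ _ → inj₁ (Equivalence.to a⇔A refl)) (λ _ → refl)
∨-⇔ {false} a⇔A b⇔B = mk⇔ (inj₂ ∘ Equivalence.to b⇔B)
  [ (λ A → ⊥-elim (true≢false (sym (Equivalence.from a⇔A A)))) , Equivalence.from b⇔B ]

⇔-∨ : ∀ {g' g x} {R : Set} → (g' ≡ true) ⇔ (g ≡ true ⊎ R) → (x ≡ true) ⇔ R → g' ≡ g ∨ x
⇔-∨ {g'} {g} {x} g'⇔ x⇔R = bool-ext
  (λ g'-true → Equivalence.from (∨-⇔ (⇔-id (g ≡ true)) x⇔R) (Equivalence.to g'⇔ g'-true))
  (λ g∨x-true → Equivalence.from g'⇔ (Equivalence.to (∨-⇔ (⇔-id (g ≡ true)) x⇔R) g∨x-true))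

countF-as-sumF : ∀ {m} (f : Fin m → Bool) → countF f ≡ sumF (λ i → ⟦ f i ⟧)
countF-as-sumF {zero}  f = refl
countF-as-sumF {suc m} f = cong (⟦ f zero ⟧ +_) (countF-as-sumF (f ∘ suc))

sumF-cong : ∀ {m} {f g : Fin m → ℕ} → (∀ i → f i ≡ g i) → sumF f ≡ sumF g
sumF-cong {zero}  e = refl
sumF-cong {suc m} e = cong₂ _+_ (e zero) (sumF-cong (e ∘ suc))

countF-cong : ∀ {m} {f g : Fin m → Bool} → (∀ i → f i ≡ g i) → countF f ≡ countF g
countF-cong {zero}  e = refl
countF-cong {suc m} e = cong₂ _+_ (cong ⟦_⟧ (e zero)) (countF-cong (e ∘ suc))

sumF-+ : ∀ {m} (f g : Fin m → ℕ) → sumF (λ i → f i + g i) ≡ sumF f + sumF g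
sumF-+ {zero}  f g = refl
sumF-+ {suc m} f g rewrite sumF-+ (f ∘ suc) (g ∘ suc) =
  interchange (f zero) (g zero) (sumF (f ∘ suc)) (sumF (g ∘ suc))

sumF-zero : ∀ {m} (f : Fin m → ℕ) → (∀ i → f i ≡ 0) → sumF f ≡ 0
sumF-zero {zero}  f e = refl
sumF-zero {suc m} f e rewrite e zero = sumF-zero (f ∘ suc) (e ∘ suc)

sumF-const : ∀ m c → sumF {m} (λ _ → c) ≡ m * c
sumF-const zero    c = refl
sumF-const (suc m) c = cong (c +_) (sumF-const m c)

sumF-*ˡ : ∀ {m} (c : ℕ) (f : Fin m → ℕ) → sumF (λ i → c * f i) ≡ c * sumF f
sumF-*ˡ {zero}  c f = sym (*-zeroʳ c)
sumF-*ˡ {suc m} c f rewrite sumF-*ˡ c (f ∘ suc) = sym (*-distribˡ-+ c (f zero) _)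

sumF-*ʳ : ∀ {m} (c : ℕ) (f : Fin m → ℕ) → sumF (λ i → f i * c) ≡ sumF f * c
sumF-*ʳ c f = trans (sumF-cong (λ i → *-comm (f i) c)) (trans (sumF-*ˡ c f) (*-comm c (sumF f)))

sumF-swap : ∀ {m k} (f : Fin m → Fin k → ℕ) →
  sumF (λ i → sumF (λ j → f i j)) ≡ sumF (λ j → sumF (λ i → f i j))
sumF-swap {zero}  {k} f = sym (sumF-zero {k} _ (λ _ → refl))
sumF-swap {suc m} {k} f rewrite sumF-swap {m} (λ i j → f (suc i) j) =
  sym (sumF-+ (λ j → f zero j) (λ j → sumF (λ i → f (suc i) j)))

sumF²-cong : ∀ {m k} {f g : Fin m → Fin k → ℕ} → (∀ i j → f i j ≡ g i j) →
  sumF (λ i → sumF (f i)) ≡ sumF (λ i → sumF (g i))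
sumF²-cong eq = sumF-cong (λ i → sumF-cong (eq i))

sumF²-+ : ∀ {m k} (f g : Fin m → Fin k → ℕ) →
  sumF (λ i → sumF (λ j → f i j + g i j)) ≡ sumF (λ i → sumF (f i)) + sumF (λ i → sumF (g i))
sumF²-+ f g = trans (sumF-cong (λ i → sumF-+ (f i) (g i))) (sumF-+ (λ i → sumF (f i)) (λ i → sumF (g i)))

sumF-mono : ∀ {m} {f g : Fin m → ℕ} → (∀ i → f i ≤ g i) → sumF f ≤ sumF g
sumF-mono {zero}  e = z≤n
sumF-mono {suc m} e = +-mono-≤ (e zero) (sumF-mono (e ∘ suc))

sumF-mono-< : ∀ {m} {f g : Fin m → ℕ} → (∀ i → f i ≤ g i) → ∀ j → f j < g j → sumF f < sumF g
sumF-mono-< {suc m} le zero    lt = +-mono-<-≤ lt (sumF-mono (le ∘ suc))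
sumF-mono-< {suc m} le (suc j) lt = +-mono-≤-< (le zero) (sumF-mono-< (le ∘ suc) j lt)

sumF-term : ∀ {m} (f : Fin m → ℕ) (i : Fin m) → f i ≤ sumF f
sumF-term f zero    = m≤m+n _ _
sumF-term f (suc i) = ≤-trans (sumF-term (f ∘ suc) i) (m≤n+m _ (f zero))

sumF-delta : ∀ {m} (w : Fin m) (h : Fin m → ℕ) → sumF (λ v → ⟦ ⌊ w ≟ᶠ v ⌋ ⟧ * h v) ≡ h w
sumF-delta {suc m} zero h = begin
  h zero + 0 + sumF {m} (λ v → 0) ≡⟨ cong (h zero + 0 +_) (sumF-zero {m} _ (λ _ → refl)) ⟩
  h zero + 0 + 0                   ≡⟨ trans (+-identityʳ _) (+-identityʳ _) ⟩
  h zero                       ∎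
  where open ≡-Reasoning
sumF-delta {suc m} (suc w) h =
  trans (sumF-cong (λ v → cong (λ b → ⟦ b ⟧ * h (suc v)) (suc≟suc v))) (sumF-delta w (h ∘ suc))
  where
  suc≟suc : ∀ v → ⌊ suc w ≟ᶠ suc v ⌋ ≡ ⌊ w ≟ᶠ v ⌋
  suc≟suc v with w ≟ᶠ v
  ... | yes _ = refl
  ... | no  _ = refl

countF-pos : ∀ {m} (f : Fin m → Bool) i → f i ≡ true → 1 ≤ countF f
countF-pos f i e = begin
  1                      ≡⟨ cong ⟦_⟧ (sym e) ⟩
  ⟦ f i ⟧                ≤⟨ sumF-term (λ i → ⟦ f i ⟧) i ⟩
  sumF (λ i → ⟦ f i ⟧)   ≡⟨ sym (countF-as-sumF f) ⟩
  countF f               ∎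
  where open ≤-Reasoning

countF-witness : ∀ {m} (f : Fin m → Bool) → 1 ≤ countF f → ∃ λ i → f i ≡ true
countF-witness {suc m} f h with f zero in eq
... | true  = zero , eq
... | false with countF-witness (f ∘ suc) h
... | i , p = suc i , p

countF-none : ∀ {m} (f : Fin m → Bool) → (∀ i → f i ≡ false) → countF f ≡ 0
countF-none f e = trans (countF-as-sumF f) (sumF-zero _ (λ i → cong ⟦_⟧ (e i)))

countF-single : ∀ {m} (f : Fin m → Bool) w → f w ≡ true → (∀ i → f i ≡ true → i ≡ w) →
  countF f ≡ 1
countF-single f w fw unique = begin
  countF f                                ≡⟨ countF-as-sumF f ⟩
  sumF (λ v → ⟦ f v ⟧)                    ≡⟨ sumF-cong pointwise ⟩
  sumF (λ v → ⟦ ⌊ w ≟ᶠ v ⌋ ⟧ * 1)         ≡⟨ sumF-delta w (λ _ → 1) ⟩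
  1                                       ∎
  where
  open ≡-Reasoning
  pointwise : ∀ v → ⟦ f v ⟧ ≡ ⟦ ⌊ w ≟ᶠ v ⌋ ⟧ * 1
  pointwise v with w ≟ᶠ v | f v in fv
  ... | yes refl | _     = cong ⟦_⟧ (trans (sym fv) fw)
  ... | no w≢v   | true  = ⊥-elim (w≢v (sym (unique v fv)))
  ... | no _     | false = refl

sumF-reindex : ∀ {d n} (σ : Fin d → Fin n) → Injective _≡_ _≡_ σ → (h : Fin n → ℕ) →
  (∀ u → (∀ i → σ i ≢ u) → h u ≡ 0) → sumF (h ∘ σ) ≡ sumF h
sumF-reindex σ σ-inj h outside = begin
  sumF (λ i → h (σ i))
    ≡⟨ sumF-cong (λ i → sym (sumF-delta (σ i) h)) ⟩
  sumF (λ i → sumF (λ u → ⟦ ⌊ σ i ≟ᶠ u ⌋ ⟧ * h u))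
    ≡⟨ sumF-swap (λ i u → ⟦ ⌊ σ i ≟ᶠ u ⌋ ⟧ * h u) ⟩
  sumF (λ u → sumF (λ i → ⟦ ⌊ σ i ≟ᶠ u ⌋ ⟧ * h u))
    ≡⟨ sumF-cong (λ u → trans (sumF-*ʳ (h u) (λ i → ⟦ ⌊ σ i ≟ᶠ u ⌋ ⟧))
                                (cong (_* h u) (sym (countF-as-sumF (λ i → ⌊ σ i ≟ᶠ u ⌋))))) ⟩
  sumF (λ u → countF (λ i → ⌊ σ i ≟ᶠ u ⌋) * h u)
    ≡⟨ sumF-cong preimage ⟩
  sumF h ∎
  where
  open ≡-Reasoning
  preimage : ∀ u → countF (λ i → ⌊ σ i ≟ᶠ u ⌋) * h u ≡ h u
  preimage u with any? (λ i → σ i ≟ᶠ u)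
  ... | yes (w , σw≡u) = trans (cong (_* h u) single) (+-identityʳ (h u))
    where
    single : countF (λ i → ⌊ σ i ≟ᶠ u ⌋) ≡ 1
    single = countF-single _ w (dec-true (σ w ≟ᶠ u) σw≡u)
               (λ i σi≟u → σ-inj (trans (witness (σ i ≟ᶠ u) σi≟u) (sym σw≡u)))
  ... | no ∄w rewrite outside u (λ i σi≡u → ∄w (i , σi≡u)) = *-zeroʳ (countF (λ i → ⌊ σ i ≟ᶠ u ⌋))

-- Writing
-- m = r + q·(d+1) with r ≤ d exhibits its shape: entry i is q + [i < r].

data DivView (d : ℕ) : ℕ → Set where
  quot-rem : ∀ q r → r < suc d → DivView d (r + q * suc d)

divView : ∀ d m → DivView d m
divView d m = subst (DivView d) (sym (m≡m%n+[m/n]*n m (suc d)))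
                (quot-rem (m / suc d) (m % suc d) (m%n<n m (suc d)))

degSeq-view : ∀ d q r (i : Fin (suc d)) → r < suc d →
  degSeq (r + q * suc d) (suc d) i ≡ q + ⟦ ⌊ toℕ i <? r ⌋ ⟧
degSeq-view d q r i r<d = cong₂ (λ a b → a + ⟦ ⌊ toℕ i <? b ⌋ ⟧) quotient remainder
  where
  remainder : (r + q * suc d) % suc d ≡ r
  remainder = trans ([m+kn]%n≡m%n r q (suc d)) (m<n⇒m%n≡m r<d)
  quotient : (r + q * suc d) / suc d ≡ q
  quotient = sym (*-cancelʳ-≡ q _ (suc d) (+-cancelˡ-≡ r _ _
    (trans (m≡m%n+[m/n]*n (r + q * suc d) (suc d))
           (cong (_+ ((r + q * suc d) / suc d) * suc d) remainder))))

⟦<suc⟧ : ∀ a b → ⟦ ⌊ a <? suc b ⌋ ⟧ ≡ ⟦ ⌊ a <? b ⌋ ⟧ + ⟦ ⌊ a ≟ b ⌋ ⟧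
⟦<suc⟧ a b with <-cmp a b
... | tri< a<b _ _ rewrite dec-true (a <? suc b) (m<n⇒m<1+n a<b) | dec-true (a <? b) a<b
                         | dec-false (a ≟ b) (<⇒≢ a<b) = refl
... | tri≈ _ a≡b _ rewrite dec-true (a <? suc b) (≤-reflexive (cong suc a≡b))
                         | dec-false (a <? b) (<-irrefl a≡b) | dec-true (a ≟ b) a≡b = refl
... | tri> _ _ b<a rewrite dec-false (a <? suc b) (λ a<1+b → ≤⇒≯ (≤-pred a<1+b) b<a)
                         | dec-false (a <? b) (<-asym b<a) | dec-false (a ≟ b) (>⇒≢ b<a) = refl

degSeq-step : ∀ d m → ∃ λ r → r < suc d ×
  (∀ (j : Fin (suc d)) → degSeq (suc m) (suc d) j ≡ degSeq m (suc d) j + ⟦ ⌊ toℕ j ≟ r ⌋ ⟧)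
degSeq-step d m with divView d m
... | quot-rem q r r<d with m≤n⇒m<n∨m≡n r<d
...   | inj₁ r+1<d = r , r<d , λ j → begin
  degSeq (suc r + q * suc d) (suc d) j              ≡⟨ degSeq-view d q (suc r) j r+1<d ⟩
  q + ⟦ ⌊ toℕ j <? suc r ⌋ ⟧                        ≡⟨ cong (q +_) (⟦<suc⟧ (toℕ j) r) ⟩
  q + (⟦ ⌊ toℕ j <? r ⌋ ⟧ + ⟦ ⌊ toℕ j ≟ r ⌋ ⟧)       ≡⟨ sym (+-assoc q _ _) ⟩
  q + ⟦ ⌊ toℕ j <? r ⌋ ⟧ + ⟦ ⌊ toℕ j ≟ r ⌋ ⟧         ≡⟨ cong (_+ ⟦ ⌊ toℕ j ≟ r ⌋ ⟧) (sym (degSeq-view d q r j r<d)) ⟩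
  degSeq (r + q * suc d) (suc d) j + ⟦ ⌊ toℕ j ≟ r ⌋ ⟧ ∎
  where open ≡-Reasoning
...   | inj₂ refl = d , r<d , λ j → begin
  degSeq (suc d + q * suc d) (suc d) j              ≡⟨ degSeq-view d (suc q) 0 j (s≤s z≤n) ⟩
  suc q + 0                                         ≡⟨ +-comm (suc q) 0 ⟩
  suc q                                             ≡⟨ +-comm 1 q ⟩
  q + 1                                             ≡⟨ cong (λ b → q + ⟦ b ⟧) (sym (dec-true (toℕ j <? suc d) (toℕ<n j))) ⟩
  q + ⟦ ⌊ toℕ j <? suc d ⌋ ⟧                        ≡⟨ cong (q +_) (⟦<suc⟧ (toℕ j) d) ⟩
  q + (⟦ ⌊ toℕ j <? d ⌋ ⟧ + ⟦ ⌊ toℕ j ≟ d ⌋ ⟧)       ≡⟨ sym (+-assoc q _ _) ⟩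
  q + ⟦ ⌊ toℕ j <? d ⌋ ⟧ + ⟦ ⌊ toℕ j ≟ d ⌋ ⟧         ≡⟨ cong (_+ ⟦ ⌊ toℕ j ≟ d ⌋ ⟧) (sym (degSeq-view d q d j r<d)) ⟩
  degSeq (d + q * suc d) (suc d) j + ⟦ ⌊ toℕ j ≟ d ⌋ ⟧ ∎
  where open ≡-Reasoning

degSeq-sum : ∀ d m → sumF (degSeq m (suc d)) ≡ m
degSeq-sum d zero    = sumF-zero (degSeq 0 (suc d)) (λ _ → refl)
degSeq-sum d (suc m) with degSeq-step d m
... | r , r<d , bump = begin
  sumF (degSeq (suc m) (suc d))
    ≡⟨ sumF-cong bump ⟩
  sumF (λ j → degSeq m (suc d) j + ⟦ ⌊ toℕ j ≟ r ⌋ ⟧)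
    ≡⟨ sumF-+ (degSeq m (suc d)) (λ j → ⟦ ⌊ toℕ j ≟ r ⌋ ⟧) ⟩
  sumF (degSeq m (suc d)) + sumF {suc d} (λ j → ⟦ ⌊ toℕ j ≟ r ⌋ ⟧)
    ≡⟨ cong₂ _+_ (degSeq-sum d m) (trans (sym (countF-as-sumF {suc d} (λ j → ⌊ toℕ j ≟ r ⌋))) exactlyOne) ⟩
  m + 1
    ≡⟨ +-comm m 1 ⟩
  suc m ∎
  where
  open ≡-Reasoning
  exactlyOne : countF {suc d} (λ j → ⌊ toℕ j ≟ r ⌋) ≡ 1
  exactlyOne = countF-single _ (fromℕ< r<d) (dec-true (toℕ (fromℕ< r<d) ≟ r) (toℕ-fromℕ< r<d))
    (λ j j≟r → toℕ-injective (trans (witness (toℕ j ≟ r) j≟r) (sym (toℕ-fromℕ< r<d))))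

degSeq-mono : ∀ d {m m'} (j : Fin (suc d)) → m ≤ m' → degSeq m (suc d) j ≤ degSeq m' (suc d) j
degSeq-mono d {m} j m≤m' =
  subst (λ x → degSeq m (suc d) j ≤ degSeq x (suc d) j) (m∸n+n≡m m≤m') (raise (_ ∸ m))
  where
  raise : ∀ k → degSeq m (suc d) j ≤ degSeq (k + m) (suc d) j
  raise zero    = ≤-refl
  raise (suc k) with degSeq-step d (k + m)
  ... | _ , _ , bump rewrite bump j = ≤-trans (raise k) (m≤m+n _ _)

degSeq-+period : ∀ d m (j : Fin (suc d)) → degSeq (m + suc d) (suc d) j ≡ suc (degSeq m (suc d) j)
degSeq-+period d m j with divView d m
... | quot-rem q r r<d = begin
  degSeq (r + q * suc d + suc d) (suc d) j ≡⟨ cong (λ x → degSeq x (suc d) j) regroup ⟩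
  degSeq (r + suc q * suc d) (suc d) j     ≡⟨ degSeq-view d (suc q) r j r<d ⟩
  suc q + ⟦ ⌊ toℕ j <? r ⌋ ⟧               ≡⟨ cong suc (sym (degSeq-view d q r j r<d)) ⟩
  suc (degSeq (r + q * suc d) (suc d) j)   ∎
  where
  open ≡-Reasoning
  regroup : r + q * suc d + suc d ≡ r + suc q * suc d
  regroup = trans (+-assoc r _ _) (cong (r +_) (+-comm (q * suc d) (suc d)))

degSeq-near : ∀ d {m m'} (j : Fin (suc d)) → m' ≤ m + suc d →
  degSeq m' (suc d) j ≤ suc (degSeq m (suc d) j)
degSeq-near d {m} {m'} j m'≤ =
  subst (degSeq m' (suc d) j ≤_) (degSeq-+period d m j) (degSeq-mono d j m'≤)

degSeq-head-max : ∀ d m (i : Fin (suc d)) → degSeq m (suc d) i ≤ degSeq m (suc d) zero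
degSeq-head-max d m i with divView d m
... | quot-rem q r r<d rewrite degSeq-view d q r i r<d | degSeq-view d q r zero r<d =
  +-monoʳ-≤ q (bit (toℕ i <? r) (0 <? r))
  where
  bit : (a? : Dec (toℕ i < r)) (b? : Dec (0 < r)) → ⟦ ⌊ a? ⌋ ⟧ ≤ ⟦ ⌊ b? ⌋ ⟧
  bit (yes _)   (yes _)  = ≤-refl
  bit (yes i<r) (no 0≮r) = ⊥-elim (0≮r (≤-<-trans z≤n i<r))
  bit (no _)    _        = z≤n

degSeq-head-min : ∀ d m (i : Fin (suc d)) → degSeq m (suc d) zero ≤ suc (degSeq m (suc d) i)
degSeq-head-min d m i with divView d m
... | quot-rem q r r<d rewrite degSeq-view d q r i r<d | degSeq-view d q r zero r<d = begin
  q + ⟦ ⌊ 0 <? r ⌋ ⟧          ≤⟨ +-monoʳ-≤ q (⟦⟧≤1 ⌊ 0 <? r ⌋) ⟩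
  q + 1                       ≡⟨ +-comm q 1 ⟩
  suc q                       ≤⟨ s≤s (m≤m+n q _) ⟩
  suc (q + ⟦ ⌊ toℕ i <? r ⌋ ⟧) ∎
  where open ≤-Reasoning

degSeq-bounded : ∀ d w m (i : Fin (suc d)) → m ≤ suc d * w → degSeq m (suc d) i ≤ w
degSeq-bounded d w m i m≤ with divView d m
... | quot-rem q zero r<d rewrite degSeq-view d q zero i r<d =
  ≤-trans (≤-reflexive (+-identityʳ q)) (*-cancelʳ-≤ q w (suc d) (≤-trans m≤ (≤-reflexive (*-comm (suc d) w))))
... | quot-rem q (suc r) r<d rewrite degSeq-view d q (suc r) i r<d = begin
  q + ⟦ ⌊ toℕ i <? suc r ⌋ ⟧ ≤⟨ +-monoʳ-≤ q (⟦⟧≤1 ⌊ toℕ i <? suc r ⌋) ⟩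
  q + 1                      ≡⟨ +-comm q 1 ⟩
  suc q                      ≤⟨ q<w ⟩
  w                          ∎
  where
  open ≤-Reasoning
  q<w : q < w
  q<w = *-cancelʳ-< (suc d) q w
          (≤-trans (s≤s (m≤n+m (q * suc d) r)) (≤-trans m≤ (≤-reflexive (*-comm (suc d) w))))

degSeq-total : ∀ m d → (d ≡ 0 → m ≡ 0) → sumF (degSeq m d) ≡ m
degSeq-total m zero    empty = sym (empty refl)
degSeq-total m (suc d) _     = degSeq-sum d m

degSeq-tail : ∀ d m (i : Fin (suc d)) →
  degSeq m (suc (suc d)) (suc i) ≡ degSeq (m ∸ degSeq m (suc (suc d)) zero) (suc d) i
degSeq-tail d m i with divView (suc d) m
... | quot-rem q zero r<d = begin
  degSeq (q * suc (suc d)) (suc (suc d)) (suc i) ≡⟨ degSeq-view (suc d) q 0 (suc i) r<d ⟩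
  q + 0                                          ≡⟨ sym (degSeq-view d q 0 i (s≤s z≤n)) ⟩
  degSeq (q * suc d) (suc d) i                   ≡⟨ cong (λ x → degSeq x (suc d) i) (sym rest) ⟩
  degSeq (q * suc (suc d) ∸ degSeq (q * suc (suc d)) (suc (suc d)) zero) (suc d) i ∎
  where
  open ≡-Reasoning
  rest : q * suc (suc d) ∸ degSeq (q * suc (suc d)) (suc (suc d)) zero ≡ q * suc d
  rest = begin
    q * suc (suc d) ∸ degSeq (q * suc (suc d)) (suc (suc d)) zero
      ≡⟨ cong (q * suc (suc d) ∸_) (trans (degSeq-view (suc d) q 0 zero r<d) (+-identityʳ q)) ⟩
    q * suc (suc d) ∸ q ≡⟨ cong (_∸ q) (*-suc q (suc d)) ⟩
    q + q * suc d ∸ q   ≡⟨ m+n∸m≡n q _ ⟩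
    q * suc d           ∎
... | quot-rem q (suc r) r<d = begin
  degSeq (suc r + q * suc (suc d)) (suc (suc d)) (suc i) ≡⟨ degSeq-view (suc d) q (suc r) (suc i) r<d ⟩
  q + ⟦ ⌊ suc (toℕ i) <? suc r ⌋ ⟧                       ≡⟨ cong (λ b → q + ⟦ b ⟧) (suc<suc (toℕ i <? r)) ⟩
  q + ⟦ ⌊ toℕ i <? r ⌋ ⟧                                 ≡⟨ sym (degSeq-view d q r i (≤-pred r<d)) ⟩
  degSeq (r + q * suc d) (suc d) i                       ≡⟨ cong (λ x → degSeq x (suc d) i) (sym rest) ⟩
  degSeq (suc r + q * suc (suc d) ∸ degSeq (suc r + q * suc (suc d)) (suc (suc d)) zero) (suc d) i ∎
  where
  open ≡-Reasoning
  suc<suc : (i<r? : Dec (toℕ i < r)) → ⌊ suc (toℕ i) <? suc r ⌋ ≡ ⌊ i<r? ⌋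
  suc<suc (yes i<r) = dec-true (suc (toℕ i) <? suc r) (s≤s i<r)
  suc<suc (no  i≮r) = dec-false (suc (toℕ i) <? suc r) (i≮r ∘ ≤-pred)
  rest : suc r + q * suc (suc d) ∸ degSeq (suc r + q * suc (suc d)) (suc (suc d)) zero ≡ r + q * suc d
  rest = begin
    suc r + q * suc (suc d) ∸ degSeq (suc r + q * suc (suc d)) (suc (suc d)) zero
      ≡⟨ cong (suc r + q * suc (suc d) ∸_) (trans (degSeq-view (suc d) q (suc r) zero r<d) (+-comm q 1)) ⟩
    suc r + q * suc (suc d) ∸ suc q ≡⟨ cong (λ x → suc r + x ∸ suc q) (*-suc q (suc d)) ⟩
    r + (q + q * suc d) ∸ q         ≡⟨ cong (_∸ q) (x∙yz≈y∙xz r q (q * suc d)) ⟩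
    q + (r + q * suc d) ∸ q         ≡⟨ m+n∸m≡n q _ ⟩
    r + q * suc d                   ∎

rising : ∀ {d} (S S' : ℕ) → Fin d → Bool
rising {d} S S' j = not ⌊ degSeq S' d j ≟ degSeq S d j ⌋

rising-pointwise : ∀ d S S' (j : Fin (suc d)) → S ≤ S' → S' ≤ S + suc d →
  ⟦ rising S S' j ⟧ + degSeq S (suc d) j ≡ degSeq S' (suc d) j
rising-pointwise d S S' j S≤S' S'≤ = oneStep (degSeq-mono d j S≤S') (degSeq-near d j S'≤)
  where
  oneStep : ∀ {x y} → x ≤ y → y ≤ suc x → ⟦ not ⌊ y ≟ x ⌋ ⟧ + x ≡ y
  oneStep {x} {y} x≤y y≤1+x with y ≟ x
  ... | yes y≡x = sym y≡x
  ... | no  y≢x = ≤-antisym (≤∧≢⇒< x≤y (y≢x ∘ sym)) y≤1+x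

rising-count : ∀ d S S' → S ≤ S' → S' ≤ S + suc d → countF (rising {suc d} S S') + S ≡ S'
rising-count d S S' S≤S' S'≤ = begin
  countF (rising {suc d} S S') + S
    ≡⟨ cong₂ _+_ (countF-as-sumF (rising {suc d} S S')) (sym (degSeq-sum d S)) ⟩
  sumF (λ j → ⟦ rising {suc d} S S' j ⟧) + sumF (degSeq S (suc d))
    ≡⟨ sym (sumF-+ (λ j → ⟦ rising {suc d} S S' j ⟧) (degSeq S (suc d))) ⟩
  sumF (λ j → ⟦ rising {suc d} S S' j ⟧ + degSeq S (suc d) j)
    ≡⟨ sumF-cong (λ j → rising-pointwise d S S' j S≤S' S'≤) ⟩
  sumF (degSeq S' (suc d))
    ≡⟨ degSeq-sum d S' ⟩
  S' ∎
  where open ≡-Reasoning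

-- Rows r with prescribed sizes x i ≤ d+1 filled cyclically into d+1 columns:
-- row i takes the columns that rise as the running total passes row i.
staircase : ∀ {d} (r : ℕ) (x : Fin r → ℕ) (S : ℕ) → Fin r → Fin d → Bool
staircase (suc r) x S zero    j = rising S (S + x zero) j
staircase (suc r) x S (suc i) j = staircase r (x ∘ suc) (S + x zero) i j

staircase-row : ∀ d r (x : Fin r → ℕ) S → (∀ i → x i ≤ suc d) →
  ∀ i → countF (staircase {suc d} r x S i) ≡ x i
staircase-row d (suc r) x S x≤ zero    = +-cancelʳ-≡ S _ _
  (trans (rising-count d S (S + x zero) (m≤m+n S _) (+-monoʳ-≤ S (x≤ zero))) (+-comm S _))
staircase-row d (suc r) x S x≤ (suc i) = staircase-row d r (x ∘ suc) (S + x zero) (x≤ ∘ suc) i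

staircase-column : ∀ d r (x : Fin r → ℕ) S → (∀ i → x i ≤ suc d) → ∀ (j : Fin (suc d)) →
  countF (λ i → staircase {suc d} r x S i j) + degSeq S (suc d) j ≡ degSeq (S + sumF x) (suc d) j
staircase-column d zero    x S x≤ j = cong (λ t → degSeq t (suc d) j) (sym (+-identityʳ S))
staircase-column d (suc r) x S x≤ j = begin
  ⟦ first ⟧ + rest + degSeq S (suc d) j       ≡⟨ cong (_+ degSeq S (suc d) j) (+-comm ⟦ first ⟧ rest) ⟩
  rest + ⟦ first ⟧ + degSeq S (suc d) j       ≡⟨ +-assoc rest ⟦ first ⟧ _ ⟩
  rest + (⟦ first ⟧ + degSeq S (suc d) j)     ≡⟨ cong (rest +_) (rising-pointwise d S S' j (m≤m+n S _) (+-monoʳ-≤ S (x≤ zero))) ⟩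
  rest + degSeq S' (suc d) j                  ≡⟨ staircase-column d r (x ∘ suc) S' (x≤ ∘ suc) j ⟩
  degSeq (S' + sumF (x ∘ suc)) (suc d) j     ≡⟨ cong (λ t → degSeq t (suc d) j) (+-assoc S _ _) ⟩
  degSeq (S + sumF x) (suc d) j               ∎
  where
  open ≡-Reasoning
  S' : ℕ
  S' = S + x zero
  first : Bool
  first = rising {suc d} S S' j
  rest : ℕ
  rest = countF (λ i → staircase {suc d} r (x ∘ suc) S' i j)

bipartiteRealisation : ∀ d₁ d₂ m → m ≤ d₁ * d₂ → Σ (Fin d₁ → Fin d₂ → Bool) λ B →
  (∀ i → countF (B i) ≡ degSeq m d₁ i) × (∀ j → countF (λ i → B i j) ≡ degSeq m d₂ j)
bipartiteRealisation zero d₂ m m≤ with n≤0⇒n≡0 m≤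
... | refl = (λ ()) , (λ ()) , noEdges d₂
  where
  noEdges : ∀ d (j : Fin d) → 0 ≡ degSeq 0 d j
  noEdges (suc d) j = refl
bipartiteRealisation (suc d₁) zero m m≤ with n≤0⇒n≡0 (≤-trans m≤ (≤-reflexive (*-zeroʳ (suc d₁))))
... | refl = (λ i ()) , (λ i → refl) , λ ()
bipartiteRealisation (suc d₁) (suc d₂) m m≤ = B , rows , columns
  where
  x : Fin (suc d₁) → ℕ
  x = degSeq m (suc d₁)
  x≤ : ∀ i → x i ≤ suc d₂
  x≤ i = degSeq-bounded d₁ (suc d₂) m i m≤
  B : Fin (suc d₁) → Fin (suc d₂) → Bool
  B = staircase {suc d₂} (suc d₁) x 0
  rows : ∀ i → countF (B i) ≡ x i
  rows = staircase-row d₂ (suc d₁) x 0 x≤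
  columns : ∀ j → countF (λ i → B i j) ≡ degSeq m (suc d₂) j
  columns j = trans (sym (+-identityʳ _))
    (trans (staircase-column d₂ (suc d₁) x 0 x≤ j) (cong (λ t → degSeq t (suc d₂) j) (degSeq-sum d₁ m)))

choose2-suc : ∀ n → suc n C 2 ≡ n + n C 2
choose2-suc n = trans (sym (nCk+nC[k+1]≡[n+1]C[k+1] n 1)) (cong (_+ n C 2) (nC1≡n n))

double-choose2 : ∀ n → 2 * (suc n C 2) ≡ suc n * n
double-choose2 zero    = refl
double-choose2 (suc n) = begin
  2 * (suc (suc n) C 2)       ≡⟨ cong (2 *_) (choose2-suc (suc n)) ⟩
  2 * (suc n + suc n C 2)     ≡⟨ *-distribˡ-+ 2 (suc n) (suc n C 2) ⟩
  2 * suc n + 2 * (suc n C 2) ≡⟨ cong (2 * suc n +_) (double-choose2 n) ⟩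
  2 * suc n + suc n * n       ≡⟨ algebra n ⟩
  suc (suc n) * suc n         ∎
  where
  open ≡-Reasoning
  algebra : ∀ n → 2 * suc n + suc n * n ≡ suc (suc n) * suc n
  algebra = solve-∀

-- The first vertex (the "hub", of largest degree x)
-- is joined to those x others whose entry rises from degSeq (2(J ∸ x)) to
-- degSeq (2J ∸ x); the remaining J ∸ x edges are placed recursively.
hubDegree : ℕ → ℕ → ℕ
hubDegree D J = degSeq (2 * J) (suc D) zero

nearRegularGraph : ∀ D (J : ℕ) → Fin D → Fin D → Bool
nearRegularGraph (suc D) J zero    zero    = false
nearRegularGraph (suc D) J zero    (suc j) = rising {D} (2 * (J ∸ hubDegree D J)) (2 * J ∸ hubDegree D J) j
nearRegularGraph (suc D) J (suc i) zero    = rising {D} (2 * (J ∸ hubDegree D J)) (2 * J ∸ hubDegree D J) i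
nearRegularGraph (suc D) J (suc i) (suc j) = nearRegularGraph D (J ∸ hubDegree D J) i j

nearRegularGraph-sym : ∀ D J i j → nearRegularGraph D J i j ≡ nearRegularGraph D J j i
nearRegularGraph-sym (suc D) J zero    zero    = refl
nearRegularGraph-sym (suc D) J zero    (suc j) = refl
nearRegularGraph-sym (suc D) J (suc i) zero    = refl
nearRegularGraph-sym (suc D) J (suc i) (suc j) = nearRegularGraph-sym D _ i j

nearRegularGraph-irr : ∀ D J i → nearRegularGraph D J i i ≡ false
nearRegularGraph-irr (suc D) J zero    = refl
nearRegularGraph-irr (suc D) J (suc i) = nearRegularGraph-irr D _ i

hub-≤-others : ∀ D J → J ≤ suc D C 2 → hubDegree D J ≤ D
hub-≤-others D J J≤ = degSeq-bounded D D (2 * J) zero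
  (≤-trans (*-monoʳ-≤ 2 J≤) (≤-reflexive (double-choose2 D)))

hub-≤-edges : ∀ D J → J ≤ suc D C 2 → hubDegree D J ≤ J
hub-≤-edges zero    J J≤ with n≤0⇒n≡0 J≤
... | refl = z≤n
hub-≤-edges (suc D) J J≤ = half (begin
  2 * x                 ≡⟨ cong (x +_) (+-identityʳ x) ⟩
  x + x                 ≤⟨ +-monoʳ-≤ x (degSeq-head-min (suc D) (2 * J) (suc zero)) ⟩
  x + suc y             ≡⟨ +-suc x y ⟩
  suc (x + y)           ≤⟨ s≤s (+-monoʳ-≤ x (m≤m+n y _)) ⟩
  suc (sumF (degSeq (2 * J) (suc (suc D)))) ≡⟨ cong suc (degSeq-sum (suc D) (2 * J)) ⟩
  suc (2 * J)           ∎)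
  where
  open ≤-Reasoning
  x : ℕ
  x = hubDegree (suc D) J
  y : ℕ
  y = degSeq (2 * J) (suc (suc D)) (suc zero)
  half : ∀ {a b} → 2 * a ≤ suc (2 * b) → a ≤ b
  half {a} {b} 2a≤ with a ≤? b
  ... | yes a≤b = a≤b
  ... | no  a≰b = ⊥-elim (1+n≰n (≤-pred (begin
    suc (suc (2 * b)) ≡⟨ sym (*-suc 2 b) ⟩
    2 * suc b         ≤⟨ *-monoʳ-≤ 2 (≰⇒> a≰b) ⟩
    2 * a             ≤⟨ 2a≤ ⟩
    suc (2 * b)       ∎)))

rest-fits : ∀ D J → J ≤ suc D C 2 → J ∸ hubDegree D J ≤ D C 2
rest-fits zero    J J≤ with n≤0⇒n≡0 J≤
... | refl = z≤n
rest-fits (suc D) J J≤ = *-cancelˡ-≤ 2 (begin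
  2 * (J ∸ x)                  ≡⟨ *-distribˡ-∸ 2 J x ⟩
  2 * J ∸ 2 * x                ≤⟨ ∸-monoˡ-≤ (2 * x) total≤ ⟩
  suc (suc D) * x ∸ 2 * x      ≡⟨ cong (_∸ 2 * x) (algebra D x) ⟩
  D * x + 2 * x ∸ 2 * x        ≡⟨ m+n∸n≡m (D * x) (2 * x) ⟩
  D * x                        ≤⟨ *-monoʳ-≤ D (hub-≤-others (suc D) J J≤) ⟩
  D * suc D                    ≡⟨ *-comm D (suc D) ⟩
  suc D * D                    ≡⟨ sym (double-choose2 D) ⟩
  2 * (suc D C 2)              ∎)
  where
  open ≤-Reasoning
  x : ℕ
  x = hubDegree (suc D) J
  total≤ : 2 * J ≤ suc (suc D) * x
  total≤ = begin
    2 * J                                    ≡⟨ sym (degSeq-sum (suc D) (2 * J)) ⟩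
    sumF (degSeq (2 * J) (suc (suc D)))      ≤⟨ sumF-mono (degSeq-head-max (suc D) (2 * J)) ⟩
    sumF {suc (suc D)} (λ _ → x)             ≡⟨ sumF-const (suc (suc D)) x ⟩
    suc (suc D) * x                          ∎
  algebra : ∀ D x → suc (suc D) * x ≡ D * x + 2 * x
  algebra = solve-∀

-- The hub gets x neighbours, and vertex i+1 gets its entry of the recursive
-- sequence plus one exactly when it rises, which is its entry of degSeq (2J).
nearRegularGraph-deg : ∀ D J → J ≤ D C 2 → ∀ i → countF (nearRegularGraph D J i) ≡ degSeq (2 * J) D i
nearRegularGraph-deg (suc zero)    J J≤ zero with n≤0⇒n≡0 J≤
... | refl = refl
nearRegularGraph-deg (suc (suc D)) J J≤ = degree
  where
  x : ℕ
  x = hubDegree (suc D) J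
  S : ℕ
  S = 2 * (J ∸ x)
  S' : ℕ
  S' = 2 * J ∸ x
  S'≡S+x : S' ≡ S + x
  S'≡S+x = begin
    2 * J ∸ x                   ≡⟨ cong (λ j → 2 * j ∸ x) (sym (m∸n+n≡m (hub-≤-edges (suc D) J J≤))) ⟩
    2 * ((J ∸ x) + x) ∸ x       ≡⟨ cong (_∸ x) (algebra (J ∸ x) x) ⟩
    (2 * (J ∸ x) + x) + x ∸ x   ≡⟨ m+n∸n≡m _ x ⟩
    2 * (J ∸ x) + x             ∎
    where
    open ≡-Reasoning
    algebra : ∀ a x → 2 * (a + x) ≡ (2 * a + x) + x
    algebra = solve-∀
  S≤S' : S ≤ S'
  S≤S' = ≤-trans (m≤m+n S x) (≤-reflexive (sym S'≡S+x))
  S'≤ : S' ≤ S + suc D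
  S'≤ = ≤-trans (≤-reflexive S'≡S+x) (+-monoʳ-≤ S (hub-≤-others (suc D) J J≤))
  degree : ∀ i → countF (nearRegularGraph (suc (suc D)) J i) ≡ degSeq (2 * J) (suc (suc D)) i
  degree zero    = +-cancelʳ-≡ S _ _ (trans (rising-count D S S' S≤S' S'≤) (trans S'≡S+x (+-comm S x)))
  degree (suc i) = begin
    ⟦ rising {suc D} S S' i ⟧ + countF (nearRegularGraph (suc D) (J ∸ x) i)
      ≡⟨ cong (⟦ rising {suc D} S S' i ⟧ +_) (nearRegularGraph-deg (suc D) (J ∸ x) (rest-fits (suc D) J J≤) i) ⟩
    ⟦ rising {suc D} S S' i ⟧ + degSeq S (suc D) i
      ≡⟨ rising-pointwise D S S' i S≤S' S'≤ ⟩
    degSeq S' (suc D) i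
      ≡⟨ sym (degSeq-tail D (2 * J) i) ⟩
    degSeq (2 * J) (suc (suc D)) (suc i) ∎
    where open ≡-Reasoning

diagonalRealisation : ∀ D J → J ≤ D C 2 → Σ (Fin D → Fin D → Bool) λ B →
  (∀ i j → B i j ≡ B j i) × (∀ i → B i i ≡ false) × (∀ i → countF (B i) ≡ degSeq (2 * J) D i)
diagonalRealisation D J J≤ =
  nearRegularGraph D J , nearRegularGraph-sym D J , nearRegularGraph-irr D J , nearRegularGraph-deg D J J≤

argmin : ∀ {n} (P : Fin n → Bool) (h : Fin n → ℕ) → (∃ λ w → P w ≡ true) →
  ∃ λ m → P m ≡ true × (∀ v → P v ≡ true → h m ≤ h v)
argmin {suc n} P h (w , Pw) with any? (λ v → P (suc v) ≟ᵇ true)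
... | no ∄later = zero , onlyZero w Pw , λ { zero _ → ≤-refl ; (suc v) Pv → ⊥-elim (∄later (v , Pv)) }
  where
  onlyZero : ∀ w → P w ≡ true → P zero ≡ true
  onlyZero zero    Pw = Pw
  onlyZero (suc v) Pv = ⊥-elim (∄later (v , Pv))
... | yes later with argmin (P ∘ suc) (h ∘ suc) later | P zero in P0
...   | m , Pm , m-min | false =
  suc m , Pm , λ { zero Pv → ⊥-elim (true≢false (trans (sym Pv) P0)) ; (suc v) Pv → m-min v Pv }
...   | m , Pm , m-min | true with h zero ≤? h (suc m)
...     | yes h0≤ = zero , P0 , λ { zero _ → ≤-refl ; (suc v) Pv → ≤-trans h0≤ (m-min v Pv) }
...     | no  h0≰ = suc m , Pm , λ { zero _ → <⇒≤ (≰⇒> h0≰) ; (suc v) Pv → m-min v Pv }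

countF-remove : ∀ {n} (P : Fin n → Bool) m → P m ≡ true →
  countF P ≡ suc (countF (λ v → P v ∧ not ⌊ v ≟ᶠ m ⌋))
countF-remove P m Pm = begin
  countF P                                                ≡⟨ countF-as-sumF P ⟩
  sumF (λ v → ⟦ P v ⟧)                                    ≡⟨ sumF-cong split ⟩
  sumF (λ v → ⟦ P v ∧ not ⌊ v ≟ᶠ m ⌋ ⟧ + ⟦ ⌊ m ≟ᶠ v ⌋ ⟧ * 1)
    ≡⟨ sumF-+ (λ v → ⟦ P v ∧ not ⌊ v ≟ᶠ m ⌋ ⟧) (λ v → ⟦ ⌊ m ≟ᶠ v ⌋ ⟧ * 1) ⟩
  sumF (λ v → ⟦ P v ∧ not ⌊ v ≟ᶠ m ⌋ ⟧) + sumF (λ v → ⟦ ⌊ m ≟ᶠ v ⌋ ⟧ * 1)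
    ≡⟨ cong₂ _+_ (sym (countF-as-sumF (λ v → P v ∧ not ⌊ v ≟ᶠ m ⌋))) (sumF-delta m (λ _ → 1)) ⟩
  countF (λ v → P v ∧ not ⌊ v ≟ᶠ m ⌋) + 1                 ≡⟨ +-comm _ 1 ⟩
  suc (countF (λ v → P v ∧ not ⌊ v ≟ᶠ m ⌋))               ∎
  where
  open ≡-Reasoning
  split : ∀ v → ⟦ P v ⟧ ≡ ⟦ P v ∧ not ⌊ v ≟ᶠ m ⌋ ⟧ + ⟦ ⌊ m ≟ᶠ v ⌋ ⟧ * 1
  split v with v ≟ᶠ m | m ≟ᶠ v
  ... | yes refl | yes _    rewrite Pm = refl
  ... | yes refl | no  m≢m  = ⊥-elim (m≢m refl)
  ... | no  v≢m  | yes refl = ⊥-elim (v≢m refl)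
  ... | no  _    | no  _    with P v
  ...   | true  = refl
  ...   | false = refl

record SortedEnumeration {n} (P : Fin n → Bool) (h : Fin n → ℕ) (c : ℕ) : Set where
  field
    σ      : Fin c → Fin n
    σ-inj  : Injective _≡_ _≡_ σ
    σ-in   : ∀ i → P (σ i) ≡ true
    σ-onto : ∀ v → P v ≡ true → ∃ λ i → σ i ≡ v
    sorted : ∀ i j → toℕ i ≤ toℕ j → h (σ i) ≤ h (σ j)

-- Selection sort: list a minimiser first, then the rest recursively.
sortedEnumeration : ∀ c {n} (P : Fin n → Bool) (h : Fin n → ℕ) → countF P ≡ c →
  SortedEnumeration P h c
sortedEnumeration zero P h #P≡0 = record
  { σ = λ () ; σ-inj = λ {} ; σ-in = λ () ; sorted = λ ()
  ; σ-onto = λ v Pv → ⊥-elim (1+n≰n (≤-trans (countF-pos P v Pv) (≤-reflexive #P≡0))) }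
sortedEnumeration (suc c) {n} P h #P≡1+c = record
  { σ = σ ; σ-inj = λ {i} {j} → σ-inj i j ; σ-in = σ-in ; σ-onto = σ-onto ; sorted = sorted }
  where
  nonempty : ∃ λ w → P w ≡ true
  nonempty = countF-witness P (≤-trans (s≤s z≤n) (≤-reflexive (sym #P≡1+c)))
  m : Fin n
  m = proj₁ (argmin P h nonempty)
  Pm : P m ≡ true
  Pm = proj₁ (proj₂ (argmin P h nonempty))
  m-min : ∀ v → P v ≡ true → h m ≤ h v
  m-min = proj₂ (proj₂ (argmin P h nonempty))
  P' : Fin n → Bool
  P' v = P v ∧ not ⌊ v ≟ᶠ m ⌋
  module Rest = SortedEnumeration (sortedEnumeration c P' h (suc-injective (trans (sym (countF-remove P m Pm)) #P≡1+c)))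
  σ : Fin (suc c) → Fin n
  σ zero    = m
  σ (suc i) = Rest.σ i
  rest-in : ∀ i → P (Rest.σ i) ≡ true × not ⌊ Rest.σ i ≟ᶠ m ⌋ ≡ true
  rest-in i = ∧-true (Rest.σ-in i)
  rest≢m : ∀ i → Rest.σ i ≢ m
  rest≢m i eq = true≢false (trans (sym (proj₂ (rest-in i))) (cong not (dec-true (Rest.σ i ≟ᶠ m) eq)))
  σ-inj : ∀ i j → σ i ≡ σ j → i ≡ j
  σ-inj zero    zero    _  = refl
  σ-inj zero    (suc j) eq = ⊥-elim (rest≢m j (sym eq))
  σ-inj (suc i) zero    eq = ⊥-elim (rest≢m i eq)
  σ-inj (suc i) (suc j) eq = cong suc (Rest.σ-inj eq)
  σ-in : ∀ i → P (σ i) ≡ true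
  σ-in zero    = Pm
  σ-in (suc i) = proj₁ (rest-in i)
  σ-onto : ∀ v → P v ≡ true → ∃ λ i → σ i ≡ v
  σ-onto v Pv with v ≟ᶠ m
  ... | yes v≡m = zero , sym v≡m
  ... | no  v≢m with Rest.σ-onto v (cong₂ _∧_ Pv (cong not (dec-false (v ≟ᶠ m) v≢m)))
  ...   | i , σi≡v = suc i , σi≡v
  sorted : ∀ i j → toℕ i ≤ toℕ j → h (σ i) ≤ h (σ j)
  sorted zero    j       _         = m-min (σ j) (σ-in j)
  sorted (suc i) (suc j) (s≤s i≤j) = Rest.sorted i j i≤j

_∪_ : ∀ {n} → Graph n → Graph n → Graph n
(G ∪ X) u v = G u v ∨ X u v

Disjoint : ∀ {n} → Graph n → Graph n → Set
Disjoint G X = ∀ u v → G u v ≡ true → X u v ≡ false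

deg-∪ : ∀ {n} (G X : Graph n) → Disjoint G X → ∀ u → deg (G ∪ X) u ≡ deg G u + deg X u
deg-∪ G X disjoint u = begin
  countF (λ v → G u v ∨ X u v)               ≡⟨ countF-as-sumF (λ v → G u v ∨ X u v) ⟩
  sumF (λ v → ⟦ G u v ∨ X u v ⟧)              ≡⟨ sumF-cong (λ v → ⟦∨⟧ (G u v) (X u v) (disjoint u v)) ⟩
  sumF (λ v → ⟦ G u v ⟧ + ⟦ X u v ⟧)          ≡⟨ sumF-+ (λ v → ⟦ G u v ⟧) (λ v → ⟦ X u v ⟧) ⟩
  sumF (λ v → ⟦ G u v ⟧) + sumF (λ v → ⟦ X u v ⟧)
    ≡⟨ cong₂ _+_ (sym (countF-as-sumF (G u))) (sym (countF-as-sumF (X u))) ⟩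
  deg G u + deg X u                           ∎
  where open ≡-Reasoning

module Placement {n d₁ d₂ : ℕ} (B : Fin d₁ → Fin d₂ → Bool)
                 (σ : Fin d₁ → Fin n) (τ : Fin d₂ → Fin n)
                 (σ-inj : Injective _≡_ _≡_ σ) (τ-inj : Injective _≡_ _≡_ τ) where

  Placed : Fin n → Fin n → Set
  Placed u v = ∃ λ i → ∃ λ j → B i j ≡ true × σ i ≡ u × τ j ≡ v

  placed? : ∀ u v → Dec (Placed u v)
  placed? u v = any? (λ i → any? (λ j → (B i j ≟ᵇ true) ×-dec (σ i ≟ᶠ u) ×-dec (τ j ≟ᶠ v)))

  placed : Graph n
  placed u v = ⌊ placed? u v ⌋

  placed-intro : ∀ {u v} → Placed u v → placed u v ≡ true
  placed-intro {u} {v} = dec-true (placed? u v)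

  placed-elim : ∀ {u v} → placed u v ≡ true → Placed u v
  placed-elim {u} {v} = witness (placed? u v)

  placed-spec : ∀ u v → (placed u v ≡ true) ⇔ Placed u v
  placed-spec u v = mk⇔ placed-elim placed-intro

  placed-at : ∀ i j → placed (σ i) (τ j) ≡ B i j
  placed-at i j = bool-ext onlyB (λ Bij → placed-intro (i , j , Bij , refl , refl))
    where
    onlyB : placed (σ i) (τ j) ≡ true → B i j ≡ true
    onlyB arc with placed-elim arc
    ... | i' , j' , Bi'j' , σi'≡σi , τj'≡τj with σ-inj σi'≡σi | τ-inj τj'≡τj
    ...   | refl | refl = Bi'j'

  placed-offRow : ∀ u v → (∀ i → σ i ≢ u) → placed u v ≡ false
  placed-offRow u v off = notTrue (λ arc → let (i , _ , _ , σi≡u , _) = placed-elim arc in off i σi≡u)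

  placed-offColumn : ∀ u v → (∀ j → τ j ≢ v) → placed u v ≡ false
  placed-offColumn u v off = notTrue (λ arc → let (_ , j , _ , _ , τj≡v) = placed-elim arc in off j τj≡v)

  placed-row : ∀ i → countF (placed (σ i)) ≡ countF (B i)
  placed-row i = begin
    countF (placed (σ i))            ≡⟨ countF-as-sumF (placed (σ i)) ⟩
    sumF (λ v → ⟦ placed (σ i) v ⟧)   ≡⟨ sym (sumF-reindex τ τ-inj _ (λ v off → cong ⟦_⟧ (placed-offColumn (σ i) v off))) ⟩
    sumF (λ j → ⟦ placed (σ i) (τ j) ⟧) ≡⟨ sumF-cong (λ j → cong ⟦_⟧ (placed-at i j)) ⟩
    sumF (λ j → ⟦ B i j ⟧)            ≡⟨ sym (countF-as-sumF (B i)) ⟩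
    countF (B i)                      ∎
    where open ≡-Reasoning

  placed-column : ∀ j → countF (λ u → placed u (τ j)) ≡ countF (λ i → B i j)
  placed-column j = begin
    countF (λ u → placed u (τ j))       ≡⟨ countF-as-sumF (λ u → placed u (τ j)) ⟩
    sumF (λ u → ⟦ placed u (τ j) ⟧)      ≡⟨ sym (sumF-reindex σ σ-inj _ (λ u off → cong ⟦_⟧ (placed-offRow u (τ j) off))) ⟩
    sumF (λ i → ⟦ placed (σ i) (τ j) ⟧)  ≡⟨ sumF-cong (λ i → cong ⟦_⟧ (placed-at i j)) ⟩
    sumF (λ i → ⟦ B i j ⟧)               ≡⟨ sym (countF-as-sumF (λ i → B i j)) ⟩
    countF (λ i → B i j)                 ∎
    where open ≡-Reasoning

  placed-total : sumF (λ u → countF (placed u)) ≡ sumF (λ i → countF (B i))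
  placed-total = trans
    (sym (sumF-reindex σ σ-inj (λ u → countF (placed u))
       (λ u off → countF-none (placed u) (λ v → placed-offRow u v off))))
    (sumF-cong placed-row)

  crossing : Graph n
  crossing u v = placed u v ∨ placed v u

  -- The relation that OffDiagStep.result asks the new edges to satisfy.
  Crossing : Fin n → Fin n → Set
  Crossing u v = ∃ λ i → ∃ λ j → B i j ≡ true × ((σ i ≡ u × τ j ≡ v) ⊎ (σ i ≡ v × τ j ≡ u))

  crossing-spec : ∀ u v → (crossing u v ≡ true) ⇔ Crossing u v
  crossing-spec u v = mk⇔ (λ arc → [ forward , backward ] (Equivalence.to either arc)) (Equivalence.from either ∘ back)
    where
    either : (crossing u v ≡ true) ⇔ (Placed u v ⊎ Placed v u)
    either = ∨-⇔ (placed-spec u v) (placed-spec v u)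
    forward : Placed u v → Crossing u v
    forward (i , j , Bij , σi≡u , τj≡v) = i , j , Bij , inj₁ (σi≡u , τj≡v)
    backward : Placed v u → Crossing u v
    backward (i , j , Bij , σi≡v , τj≡u) = i , j , Bij , inj₂ (σi≡v , τj≡u)
    back : Crossing u v → Placed u v ⊎ Placed v u
    back (i , j , Bij , inj₁ (σi≡u , τj≡v)) = inj₁ (i , j , Bij , σi≡u , τj≡v)
    back (i , j , Bij , inj₂ (σi≡v , τj≡u)) = inj₂ (i , j , Bij , σi≡v , τj≡u)

residual-antitone : ∀ t {x y} → x ≤ y → ℤ.+ t ℤ.- ℤ.+ y ℤ.≤ ℤ.+ t ℤ.- ℤ.+ x
residual-antitone t x≤y = ℤP.+-monoʳ-≤ (ℤ.+ t) (ℤP.neg-mono-≤ (ℤ.+≤+ x≤y))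

residual-reflects : ∀ t {x y} → ℤ.+ t ℤ.- ℤ.+ y ℤ.≤ ℤ.+ t ℤ.- ℤ.+ x → x ≤ y
residual-reflects t {x} {y} res≤ with x ≤? y
... | yes x≤y = x≤y
... | no  x≰y = ⊥-elim (ℤP.≤⇒≯ res≤ (ℤP.+-monoʳ-< (ℤ.+ t) (ℤP.neg-mono-< (ℤ.+<+ (≰⇒> x≰y)))))

inClass : ∀ {n} → (Fin n → ℕ) → ℕ → Fin n → Bool
inClass tdeg k v = ⌊ tdeg v ≟ k ⌋

-- A class listed by increasing current degree, i.e. decreasing residual
-- degree: whatever the number a of larger entries of B, it is a valid matching.
classEnumeration : ∀ {n} (tdeg : Fin n → ℕ) (G : Graph n) k d → countF (inClass tdeg k) ≡ d →
  Σ (Fin d → Fin n) λ σ → ClassBij tdeg k d σ × (∀ a → ResidualOrdered tdeg G a d σ)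
classEnumeration tdeg G k d size =
  E.σ , (E.σ-inj , inK , (λ v tv≡k → E.σ-onto v (dec-true (tdeg v ≟ k) tv≡k))) , ordered
  where
  module E = SortedEnumeration (sortedEnumeration d (inClass tdeg k) (deg G) size)
  inK : ∀ i → tdeg (E.σ i) ≡ k
  inK i = witness (tdeg (E.σ i) ≟ k) (E.σ-in i)
  ordered : ∀ a → ResidualOrdered tdeg G a d E.σ
  ordered a i i' i<a a≤i' rewrite inK i | inK i' =
    residual-antitone k (E.sorted i i' (≤-trans (<⇒≤ i<a) a≤i'))

-- Every step of Algorithm 1 can be carried out, whatever the current graph:
-- B exists by the bounds on J, and the matchings by sorting each class.
stepExists : (J : Matrix) (N : ℕ) {n : ℕ} (tdeg : Fin n → ℕ) →
  (∀ k l → k ≢ l → J k l ≤ D J N k * D J N l) → (∀ k → J k k ≤ D J N k C 2) →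
  (∀ k → 1 ≤ k → countF (inClass tdeg k) ≡ D J N k) →
  ∀ k l → 1 ≤ k → 1 ≤ l → (G : Graph n) → ∃ λ G' → Step J N tdeg (k , l) G G'
stepExists J N tdeg offBound diagBound classSize k l 1≤k 1≤l G with k ≟ l
... | yes refl
  with diagonalRealisation (D J N k) (J k k) (diagBound k) | classEnumeration tdeg G k (D J N k) (classSize k 1≤k)
...   | B , B-sym , B-irr , degB | σ , σ-bij , σ-ord = G ∪ placed , record
  { B = B ; B-sym = B-sym ; B-irr = B-irr ; degB = degB ; σ = σ ; σ-bij = σ-bij ; σ-ord = σ-ord _
  ; result = λ u v → ∨-⇔ (⇔-id _) (placed-spec u v) }
  where open Placement B σ σ (proj₁ σ-bij) (proj₁ σ-bij)
stepExists J N tdeg offBound diagBound classSize k l 1≤k 1≤l G | no k≢l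
  with bipartiteRealisation (D J N k) (D J N l) (J k l) (offBound k l k≢l)
     | classEnumeration tdeg G k (D J N k) (classSize k 1≤k) | classEnumeration tdeg G l (D J N l) (classSize l 1≤l)
...   | B , rowDeg , colDeg | σ , σ-bij , σ-ord | τ , τ-bij , τ-ord = G ∪ crossing , record
  { B = B ; rowDeg = rowDeg ; colDeg = colDeg ; σ = σ ; τ = τ ; σ-bij = σ-bij ; τ-bij = τ-bij
  ; σ-ord = σ-ord _ ; τ-ord = τ-ord _ ; result = λ u v → ∨-⇔ (⇔-id _) (crossing-spec u v) }
  where open Placement B σ τ (proj₁ σ-bij) (proj₁ τ-bij)

_≟ₚ_ : (p q : ℕ × ℕ) → Dec (p ≡ q)
_≟ₚ_ = ×-≡-dec _≟_ _≟_

occ : List (ℕ × ℕ) → ℕ × ℕ → ℕ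
occ []       x = 0
occ (p ∷ ps) x = ⟦ ⌊ p ≟ₚ x ⌋ ⟧ + occ ps x

occ-++ : ∀ xs ys x → occ (xs ++ ys) x ≡ occ xs x + occ ys x
occ-++ []       ys x = refl
occ-++ (p ∷ xs) ys x = trans (cong (⟦ ⌊ p ≟ₚ x ⌋ ⟧ +_) (occ-++ xs ys x)) (sym (+-assoc _ (occ xs x) (occ ys x)))

row : ℕ → ℕ → List (ℕ × ℕ)
row c m = map (λ l → (c , l)) (range1↓ m)

occ-row-out : ∀ c m a b → ¬ (c ≡ a × 1 ≤ b × b ≤ m) → occ (row c m) (a , b) ≡ 0
occ-row-out c zero    a b _   = refl
occ-row-out c (suc m) a b out
  rewrite dec-false ((c , suc m) ≟ₚ (a , b))
            (λ eq → out (,-injectiveˡ eq , subst (1 ≤_) (,-injectiveʳ eq) (s≤s z≤n) , ≤-reflexive (sym (,-injectiveʳ eq))))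
  = occ-row-out c m a b (λ { (c≡a , 1≤b , b≤m) → out (c≡a , 1≤b , m≤n⇒m≤1+n b≤m) })

occ-row-in : ∀ c m b → 1 ≤ b → b ≤ m → occ (row c m) (c , b) ≡ 1
occ-row-in c zero    (suc b) _ ()
occ-row-in c (suc m) b 1≤b b≤1+m with b ≟ suc m
... | yes refl rewrite dec-true ((c , suc m) ≟ₚ (c , suc m)) refl =
  cong suc (occ-row-out c m c (suc m) (λ { (_ , _ , 1+m≤m) → 1+n≰n 1+m≤m }))
... | no  b≢1+m rewrite dec-false ((c , suc m) ≟ₚ (c , b)) (λ eq → b≢1+m (sym (,-injectiveʳ eq))) =
  occ-row-in c m b 1≤b (≤-pred (≤∧≢⇒< b≤1+m b≢1+m))

Scheduled : ℕ → ℕ → ℕ → Set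
Scheduled N a b = 1 ≤ b × b ≤ a × a ≤ N

scheduled? : ∀ N a b → Dec (Scheduled N a b)
scheduled? N a b = (1 ≤? b) ×-dec (b ≤? a) ×-dec (a ≤? N)

occ-pairs-out : ∀ N a b → ¬ Scheduled N a b → occ (pairs N) (a , b) ≡ 0
occ-pairs-out zero    a b _ = refl
occ-pairs-out (suc N) a b out rewrite occ-++ (row (suc N) (suc N)) (pairs N) (a , b) =
  cong₂ _+_ (occ-row-out (suc N) (suc N) a b (λ { (refl , 1≤b , b≤a) → out (1≤b , b≤a , ≤-refl) }))
            (occ-pairs-out N a b (λ { (1≤b , b≤a , a≤N) → out (1≤b , b≤a , m≤n⇒m≤1+n a≤N) }))

occ-pairs-in : ∀ N a b → Scheduled N a b → occ (pairs N) (a , b) ≡ 1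
occ-pairs-in zero    a b (1≤b , b≤a , a≤0) = ⊥-elim (1+n≰n (≤-trans 1≤b (≤-trans b≤a a≤0)))
occ-pairs-in (suc N) a b (1≤b , b≤a , a≤1+N) rewrite occ-++ (row (suc N) (suc N)) (pairs N) (a , b) with a ≟ suc N
... | yes refl = cong₂ _+_ (occ-row-in (suc N) (suc N) b 1≤b b≤a)
                           (occ-pairs-out N a b (λ { (_ , _ , 1+N≤N) → 1+n≰n 1+N≤N }))
... | no  a≢1+N = cong₂ _+_ (occ-row-out (suc N) (suc N) a b (λ { (1+N≡a , _) → a≢1+N (sym 1+N≡a) }))
                            (occ-pairs-in N a b (1≤b , b≤a , ≤-pred (≤∧≢⇒< a≤1+N a≢1+N)))

-- How often the unordered pair {a, b} occurs in a list (a pair (a, a) counts twice).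
timesProcessed : List (ℕ × ℕ) → ℕ → ℕ → ℕ
timesProcessed ps a b = occ ps (a , b) + occ ps (b , a)

timesProcessed-snoc : ∀ ps p a b →
  timesProcessed (ps ++ p ∷ []) a b ≡ timesProcessed ps a b + (⟦ ⌊ p ≟ₚ (a , b) ⌋ ⟧ + ⟦ ⌊ p ≟ₚ (b , a) ⌋ ⟧)
timesProcessed-snoc ps p a b rewrite occ-++ ps (p ∷ []) (a , b) | occ-++ ps (p ∷ []) (b , a) =
  algebra (occ ps (a , b)) (occ ps (b , a)) ⟦ ⌊ p ≟ₚ (a , b) ⌋ ⟧ ⟦ ⌊ p ≟ₚ (b , a) ⌋ ⟧
  where
  algebra : ∀ o₁ o₂ e₁ e₂ → o₁ + (e₁ + 0) + (o₂ + (e₂ + 0)) ≡ o₁ + o₂ + (e₁ + e₂)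
  algebra = solve-∀

timesProcessed-all : ∀ N a b → 1 ≤ a → a ≤ N → 1 ≤ b → b ≤ N → timesProcessed (pairs N) a b ≡ 1 + ⟦ ⌊ a ≟ b ⌋ ⟧
timesProcessed-all N a b 1≤a a≤N 1≤b b≤N with <-cmp a b
... | tri< a<b _ _ rewrite occ-pairs-out N a b (λ { (_ , b≤a , _) → <⇒≱ a<b b≤a })
                        | occ-pairs-in N b a (1≤a , <⇒≤ a<b , b≤N) | dec-false (a ≟ b) (<⇒≢ a<b) = refl
... | tri> _ _ b<a rewrite occ-pairs-in N a b (1≤b , <⇒≤ b<a , a≤N)
                        | occ-pairs-out N b a (λ { (_ , a≤b , _) → <⇒≱ b<a a≤b }) | dec-false (a ≟ b) (>⇒≢ b<a) = refl
... | tri≈ _ refl _ rewrite occ-pairs-in N a a (1≤a , ≤-refl , a≤N) | dec-true (a ≟ a) refl = refl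

fresh : ∀ N ps qs k l → pairs N ≡ ps ++ ((k , l) ∷ qs) → Scheduled N k l × timesProcessed ps k l ≡ 0
fresh N ps qs k l split = scheduled , cong₂ _+_ notBefore mirrorNotBefore
  where
  total : occ (pairs N) (k , l) ≡ occ ps (k , l) + suc (occ qs (k , l))
  total rewrite split | occ-++ ps ((k , l) ∷ qs) (k , l) | dec-true ((k , l) ≟ₚ (k , l)) refl = refl
  scheduled : Scheduled N k l
  scheduled with scheduled? N k l
  ... | yes s = s
  ... | no ¬s = ⊥-elim (0≢1+n (trans (sym (occ-pairs-out N k l ¬s)) (trans total (+-suc _ _))))
  notBefore : occ ps (k , l) ≡ 0
  notBefore = m+n≡0⇒m≡0 (occ ps (k , l)) (suc-injective
    (trans (sym (+-suc (occ ps (k , l)) (occ qs (k , l)))) (trans (sym total) (occ-pairs-in N k l scheduled))))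
  l≤k : l ≤ k
  l≤k = proj₁ (proj₂ scheduled)
  mirrorNotBefore : occ ps (l , k) ≡ 0
  mirrorNotBefore with l ≟ k
  ... | yes refl = notBefore
  ... | no  l≢k  = n≤0⇒n≡0 (begin
    occ ps (l , k)                               ≤⟨ m≤m+n _ _ ⟩
    occ ps (l , k) + occ ((k , l) ∷ qs) (l , k)  ≡⟨ sym (occ-++ ps _ (l , k)) ⟩
    occ (ps ++ (k , l) ∷ qs) (l , k)             ≡⟨ cong (λ xs → occ xs (l , k)) (sym split) ⟩
    occ (pairs N) (l , k)                        ≡⟨ occ-pairs-out N l k (λ { (_ , k≤l , _) → l≢k (≤-antisym l≤k k≤l) }) ⟩
    0                                            ∎)
    where open ≤-Reasoning

module ArcCounting {n : ℕ} (tdeg : Fin n → ℕ) where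

  between : ℕ → ℕ → Fin n → Fin n → Bool
  between a b u v = inClass tdeg a u ∧ inClass tdeg b v

  arcsBetween : Graph n → ℕ → ℕ → ℕ
  arcsBetween G a b = sumF (λ u → sumF (λ v → ⟦ G u v ∧ between a b u v ⟧))

  arcsBetween-∪ : ∀ (G X : Graph n) → Disjoint G X → ∀ a b →
    arcsBetween (G ∪ X) a b ≡ arcsBetween G a b + arcsBetween X a b
  arcsBetween-∪ G X disjoint a b = trans
    (sumF²-cong (λ u v → split (G u v) (X u v) (between a b u v) (disjoint u v)))
    (sumF²-+ (λ u v → ⟦ G u v ∧ between a b u v ⟧) (λ u v → ⟦ X u v ∧ between a b u v ⟧))
    where
    split : ∀ g x c → (g ≡ true → x ≡ false) → ⟦ (g ∨ x) ∧ c ⟧ ≡ ⟦ g ∧ c ⟧ + ⟦ x ∧ c ⟧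
    split true  x c disj rewrite disj refl = sym (+-identityʳ _)
    split false x c _ = refl

  arcsBetween-pos : ∀ G u v → G u v ≡ true → 1 ≤ arcsBetween G (tdeg u) (tdeg v)
  arcsBetween-pos G u v arc = begin
    1 ≡⟨ cong ⟦_⟧ (sym counted) ⟩
    ⟦ G u v ∧ between (tdeg u) (tdeg v) u v ⟧
      ≤⟨ sumF-term (λ y → ⟦ G u y ∧ between (tdeg u) (tdeg v) u y ⟧) v ⟩
    sumF (λ y → ⟦ G u y ∧ between (tdeg u) (tdeg v) u y ⟧)
      ≤⟨ sumF-term (λ x → sumF (λ y → ⟦ G x y ∧ between (tdeg u) (tdeg v) x y ⟧)) u ⟩
    arcsBetween G (tdeg u) (tdeg v) ∎
    where
    open ≤-Reasoning
    counted : G u v ∧ between (tdeg u) (tdeg v) u v ≡ true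
    counted rewrite arc | dec-true (tdeg u ≟ tdeg u) refl | dec-true (tdeg v ≟ tdeg v) refl = refl

  arcsBetween-localised : ∀ (P : Graph n) k l → (∀ u v → P u v ≡ true → tdeg u ≡ k × tdeg v ≡ l) →
    ∀ a b → arcsBetween P a b ≡ ⟦ ⌊ (k , l) ≟ₚ (a , b) ⌋ ⟧ * sumF (λ u → countF (P u))
  arcsBetween-localised P k l ends a b = begin
    arcsBetween P a b
      ≡⟨ sumF²-cong (λ u v → pointwise u v) ⟩
    sumF (λ u → sumF (λ v → e * ⟦ P u v ⟧))
      ≡⟨ sumF-cong (λ u → trans (sumF-*ˡ e (λ v → ⟦ P u v ⟧)) (cong (e *_) (sym (countF-as-sumF (P u))))) ⟩
    sumF (λ u → e * countF (P u))
      ≡⟨ sumF-*ˡ e (λ u → countF (P u)) ⟩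
    e * sumF (λ u → countF (P u)) ∎
    where
    open ≡-Reasoning
    e : ℕ
    e = ⟦ ⌊ (k , l) ≟ₚ (a , b) ⌋ ⟧
    sameEnds : ∀ u v → P u v ≡ true → between a b u v ≡ ⌊ (k , l) ≟ₚ (a , b) ⌋
    sameEnds u v arc with ends u v arc
    ... | refl , refl = bool-ext
      (λ both → let (u∈a , v∈b) = ∧-true both in
         dec-true ((tdeg u , tdeg v) ≟ₚ (a , b)) (cong₂ _,_ (witness (tdeg u ≟ a) u∈a) (witness (tdeg v ≟ b) v∈b)))
      (λ same → let eq = witness ((tdeg u , tdeg v) ≟ₚ (a , b)) same in
         cong₂ _∧_ (dec-true (tdeg u ≟ a) (,-injectiveˡ eq)) (dec-true (tdeg v ≟ b) (,-injectiveʳ eq)))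
    pointwise : ∀ u v → ⟦ P u v ∧ between a b u v ⟧ ≡ e * ⟦ P u v ⟧
    pointwise u v with P u v in arc
    ... | true  = trans (cong ⟦_⟧ (sameEnds u v arc)) (sym (*-identityʳ e))
    ... | false = sym (*-zeroʳ e)

  arcsBetween-transpose : ∀ (P : Graph n) a b → arcsBetween (λ u v → P v u) a b ≡ arcsBetween P b a
  arcsBetween-transpose P a b = trans
    (sumF-swap (λ u v → ⟦ P v u ∧ between a b u v ⟧))
    (sumF²-cong (λ v u → cong (λ c → ⟦ P v u ∧ c ⟧) (∧-comm (inClass tdeg a u) (inClass tdeg b v))))

gap-step : ∀ du dv (b b' : Bool) → du ≤ suc dv → (b ≡ true → b' ≡ false → du ≤ dv) →
  du + ⟦ b ⟧ ≤ suc (dv + ⟦ b' ⟧)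
gap-step du dv true  true  du≤ _    = subst₂ _≤_ (+-comm 1 du) (cong suc (+-comm 1 dv)) (s≤s du≤)
gap-step du dv true  false _   rule = subst₂ _≤_ (+-comm 1 du) (cong suc (sym (+-identityʳ dv))) (s≤s (rule refl refl))
gap-step du dv false true  du≤ _    = subst₂ _≤_ (sym (+-identityʳ du)) (cong suc (+-comm 1 dv)) (m≤n⇒m≤1+n du≤)
gap-step du dv false false du≤ _    = subst₂ _≤_ (sym (+-identityʳ du)) (cong suc (sym (+-identityʳ dv))) du≤

-- The same for the increments of a near-regular sequence: entries i and i'
-- differ only when i is among the first (m mod d) and i' is not.
degSeq-balance : ∀ m d (i i' : Fin d) du dv → du ≤ suc dv →
  (toℕ i < m mod′ d → m mod′ d ≤ toℕ i' → du ≤ dv) →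
  du + degSeq m d i ≤ suc (dv + degSeq m d i')
degSeq-balance m d i i' du dv du≤ rule = begin
  du + (q + ⟦ b ⟧)        ≡⟨ x∙yz≈y∙xz du q ⟦ b ⟧ ⟩
  q + (du + ⟦ b ⟧)        ≤⟨ +-monoʳ-≤ q (gap-step du dv b b' du≤ rule′) ⟩
  q + suc (dv + ⟦ b' ⟧)   ≡⟨ +-suc q _ ⟩
  suc (q + (dv + ⟦ b' ⟧)) ≡⟨ cong suc (x∙yz≈y∙xz q dv ⟦ b' ⟧) ⟩
  suc (dv + (q + ⟦ b' ⟧)) ∎
  where
  open ≤-Reasoning
  q : ℕ
  q = m div′ d
  b : Bool
  b = ⌊ toℕ i <? m mod′ d ⌋
  b' : Bool
  b' = ⌊ toℕ i' <? m mod′ d ⌋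
  rule′ : b ≡ true → b' ≡ false → du ≤ dv
  rule′ i<r i'≮r = rule (witness (toℕ i <? m mod′ d) i<r)
    (≮⇒≥ (λ i'<r → true≢false (trans (sym (dec-true (toℕ i' <? m mod′ d) i'<r)) i'≮r)))

classBalance : ∀ {n} (tdeg : Fin n → ℕ) (G X : Graph n) k m d (σ : Fin d → Fin n) →
  ClassBij tdeg k d σ → ResidualOrdered tdeg G (m mod′ d) d σ →
  (∀ i → deg X (σ i) ≡ degSeq m d i) →
  ∀ u v → tdeg u ≡ k → tdeg v ≡ k → deg G u ≤ suc (deg G v) →
  deg G u + deg X u ≤ suc (deg G v + deg X v)
classBalance tdeg G X k m d σ (_ , inK , onto) ordered degX u v uk vk du≤
  with onto u uk | onto v vk
... | i , refl | i' , refl rewrite degX i | degX i' =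
  degSeq-balance m d i i' _ _ du≤ (λ i<r r≤i' → residual-reflects k
    (subst₂ (λ t t' → ℤ.+ t' ℤ.- ℤ.+ deg G (σ i') ℤ.≤ ℤ.+ t ℤ.- ℤ.+ deg G (σ i)) (inK i) (inK i')
       (ordered i i' i<r r≤i')))

weighted-pair : ∀ (e₁ e₂ : Bool) c j → (e₁ ≡ true → j ≡ c) → (e₂ ≡ true → j ≡ c) →
  ⟦ e₁ ⟧ * c + ⟦ e₂ ⟧ * c ≡ j * (⟦ e₁ ⟧ + ⟦ e₂ ⟧)
weighted-pair true  e₂ c j j≡c _ rewrite j≡c refl = trans (sym (*-distribʳ-+ c 1 ⟦ e₂ ⟧)) (*-comm _ c)
weighted-pair false true  c j _ j≡c rewrite j≡c refl = trans (+-identityʳ c) (sym (*-identityʳ c))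
weighted-pair false false c j _ _ = sym (*-zeroʳ j)

module AlgorithmInvariant (J : Matrix) (N : ℕ) {n : ℕ} (tdeg : Fin n → ℕ) where
  open ArcCounting tdeg public

  record Invariant (processed : List (ℕ × ℕ)) (G : Graph n) : Set where
    field
      symmetric : ∀ u v → G u v ≡ G v u
      loopless  : ∀ u → G u u ≡ false
      arcCount  : ∀ a b → arcsBetween G a b ≡ J a b * timesProcessed processed a b
      balanced  : ∀ u v → tdeg u ≡ tdeg v → deg G u ≤ suc (deg G v)

  invariant-empty : Invariant [] emptyGraph
  invariant-empty = record
    { symmetric = λ _ _ → refl
    ; loopless  = λ _ → refl
    ; arcCount  = λ a b → trans (sumF-zero {n} _ (λ u → sumF-zero {n} _ (λ v → refl))) (sym (*-zeroʳ (J a b)))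
    ; balanced  = λ u v _ → ≤-trans (≤-reflexive (countF-none {n} (λ _ → false) (λ _ → refl))) z≤n
    }

  ArcsOfPair : ℕ × ℕ → Graph n → Set
  ArcsOfPair p X = ∀ a b → arcsBetween X a b ≡ J a b * (⟦ ⌊ p ≟ₚ (a , b) ⌋ ⟧ + ⟦ ⌊ p ≟ₚ (b , a) ⌋ ⟧)

  invariant-∪ : ∀ {processed p G G'} (X : Graph n) → Invariant processed G →
    (∀ u v → G' u v ≡ (G ∪ X) u v) →
    (∀ u v → X u v ≡ X v u) → (∀ u → X u u ≡ false) → Disjoint G X → ArcsOfPair p X →
    (∀ u v → tdeg u ≡ tdeg v → deg G u ≤ suc (deg G v) → deg G u + deg X u ≤ suc (deg G v + deg X v)) →
    Invariant (processed ++ p ∷ []) G'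
  invariant-∪ {processed} {p} {G} {G'} X I G'≡ X-sym X-loopless disjoint arcsX balanceX = record
    { symmetric = λ u v → trans (G'≡ u v) (trans (cong₂ _∨_ (symmetric u v) (X-sym u v)) (sym (G'≡ v u)))
    ; loopless  = λ u → trans (G'≡ u u) (cong₂ _∨_ (loopless u) (X-loopless u))
    ; arcCount  = arcCount′
    ; balanced  = λ u v same →
        subst₂ (λ x y → x ≤ suc y) (sym (deg′ u)) (sym (deg′ v)) (balanceX u v same (balanced u v same))
    }
    where
    open Invariant I
    deg′ : ∀ u → deg G' u ≡ deg G u + deg X u
    deg′ u = trans (countF-cong (G'≡ u)) (deg-∪ G X disjoint u)
    arcCount′ : ∀ a b → arcsBetween G' a b ≡ J a b * timesProcessed (processed ++ p ∷ []) a b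
    arcCount′ a b = begin
      arcsBetween G' a b
        ≡⟨ sumF²-cong (λ u v → cong (λ e → ⟦ e ∧ between a b u v ⟧) (G'≡ u v)) ⟩
      arcsBetween (G ∪ X) a b
        ≡⟨ arcsBetween-∪ G X disjoint a b ⟩
      arcsBetween G a b + arcsBetween X a b
        ≡⟨ cong₂ _+_ (arcCount a b) (arcsX a b) ⟩
      J a b * timesProcessed processed a b + J a b * (⟦ ⌊ p ≟ₚ (a , b) ⌋ ⟧ + ⟦ ⌊ p ≟ₚ (b , a) ⌋ ⟧)
        ≡⟨ sym (*-distribˡ-+ (J a b) _ _) ⟩
      J a b * (timesProcessed processed a b + (⟦ ⌊ p ≟ₚ (a , b) ⌋ ⟧ + ⟦ ⌊ p ≟ₚ (b , a) ⌋ ⟧))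
        ≡⟨ cong (J a b *_) (sym (timesProcessed-snoc processed p a b)) ⟩
      J a b * timesProcessed (processed ++ p ∷ []) a b ∎
      where open ≡-Reasoning

  noArcYet : ∀ {processed G} → Invariant processed G → ∀ {a b} → timesProcessed processed a b ≡ 0 →
    ∀ u v → G u v ≡ true → tdeg u ≡ a → tdeg v ≡ b → ⊥
  noArcYet {processed} {G} I {a} {b} unprocessed u v arc refl refl = 1+n≰n (begin
    1                                    ≤⟨ arcsBetween-pos G u v arc ⟩
    arcsBetween G a b                    ≡⟨ Invariant.arcCount I a b ⟩
    J a b * timesProcessed processed a b ≡⟨ cong (J a b *_) unprocessed ⟩
    J a b * 0                            ≡⟨ *-zeroʳ (J a b) ⟩
    0                                    ∎)
    where open ≤-Reasoning

  module OffDiagonalArcs {G G' : Graph n} {k l : ℕ} (k≢l : k ≢ l) (J-sym : ∀ a b → J a b ≡ J b a)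
    (bound : J k l ≤ D J N k * D J N l) (st : OffDiagStep J N tdeg k l G G') where

    open OffDiagStep st
    open Placement B σ τ (proj₁ σ-bij) (proj₁ τ-bij) public

    placedᵀ : Graph n
    placedᵀ u v = placed v u

    -- Placed arcs run from class k to class l, so never in both directions.
    ends : ∀ u v → placed u v ≡ true → tdeg u ≡ k × tdeg v ≡ l
    ends u v arc = let (i , j , _ , σi≡u , τj≡v) = placed-elim arc in
      trans (cong tdeg (sym σi≡u)) (proj₁ (proj₂ σ-bij) i) , trans (cong tdeg (sym τj≡v)) (proj₁ (proj₂ τ-bij) j)

    oneWay : Disjoint placed placedᵀ
    oneWay u v arc = notTrue (λ back → k≢l (trans (sym (proj₁ (ends u v arc))) (proj₂ (ends v u back))))

    G'≡ : ∀ u v → G' u v ≡ (G ∪ crossing) u v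
    G'≡ u v = ⇔-∨ (result u v) (crossing-spec u v)

    X-sym : ∀ u v → crossing u v ≡ crossing v u
    X-sym u v = ∨-comm (placed u v) (placed v u)

    X-loopless : ∀ u → crossing u u ≡ false
    X-loopless u rewrite notTrue (λ loop → k≢l (trans (sym (proj₁ (ends u u loop))) (proj₂ (ends u u loop)))) = refl

    total : sumF (λ u → countF (placed u)) ≡ J k l
    total = trans placed-total (trans (sumF-cong rowDeg)
      (degSeq-total (J k l) (D J N k)
        (λ Dk≡0 → n≤0⇒n≡0 (≤-trans bound (≤-reflexive (cong (_* D J N l) Dk≡0))))))

    arcsX : ArcsOfPair (k , l) crossing
    arcsX a b = begin
      arcsBetween (placed ∪ placedᵀ) a b
        ≡⟨ arcsBetween-∪ placed placedᵀ oneWay a b ⟩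
      arcsBetween placed a b + arcsBetween placedᵀ a b
        ≡⟨ cong (arcsBetween placed a b +_) (arcsBetween-transpose placed a b) ⟩
      arcsBetween placed a b + arcsBetween placed b a
        ≡⟨ cong₂ _+_ (arcsBetween-localised placed k l ends a b) (arcsBetween-localised placed k l ends b a) ⟩
      ⟦ ⌊ (k , l) ≟ₚ (a , b) ⌋ ⟧ * sumF (λ u → countF (placed u))
        + ⟦ ⌊ (k , l) ≟ₚ (b , a) ⌋ ⟧ * sumF (λ u → countF (placed u))
        ≡⟨ cong₂ (λ x y → ⟦ ⌊ (k , l) ≟ₚ (a , b) ⌋ ⟧ * x + ⟦ ⌊ (k , l) ≟ₚ (b , a) ⌋ ⟧ * y) total total ⟩
      ⟦ ⌊ (k , l) ≟ₚ (a , b) ⌋ ⟧ * J k l + ⟦ ⌊ (k , l) ≟ₚ (b , a) ⌋ ⟧ * J k l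
        ≡⟨ weighted-pair _ _ (J k l) (J a b) same reversed ⟩
      J a b * (⟦ ⌊ (k , l) ≟ₚ (a , b) ⌋ ⟧ + ⟦ ⌊ (k , l) ≟ₚ (b , a) ⌋ ⟧) ∎
      where
      open ≡-Reasoning
      same : ⌊ (k , l) ≟ₚ (a , b) ⌋ ≡ true → J a b ≡ J k l
      same e with witness ((k , l) ≟ₚ (a , b)) e
      ... | refl = refl
      reversed : ⌊ (k , l) ≟ₚ (b , a) ⌋ ≡ true → J a b ≡ J k l
      reversed e with witness ((k , l) ≟ₚ (b , a)) e
      ... | refl = J-sym l k

    degRow : ∀ i → deg crossing (σ i) ≡ degSeq (J k l) (D J N k) i
    degRow i = begin
      deg (placed ∪ placedᵀ) (σ i)            ≡⟨ deg-∪ placed placedᵀ oneWay (σ i) ⟩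
      deg placed (σ i) + deg placedᵀ (σ i)    ≡⟨ cong₂ _+_ (placed-row i) (countF-none (placedᵀ (σ i)) notInto) ⟩
      countF (B i) + 0                        ≡⟨ trans (+-identityʳ _) (rowDeg i) ⟩
      degSeq (J k l) (D J N k) i              ∎
      where
      open ≡-Reasoning
      notInto : ∀ v → placed v (σ i) ≡ false
      notInto v = notTrue (λ arc → k≢l (trans (sym (proj₁ (proj₂ σ-bij) i)) (proj₂ (ends v (σ i) arc))))

    degColumn : ∀ j → deg crossing (τ j) ≡ degSeq (J k l) (D J N l) j
    degColumn j = begin
      deg (placed ∪ placedᵀ) (τ j)            ≡⟨ deg-∪ placed placedᵀ oneWay (τ j) ⟩
      deg placed (τ j) + deg placedᵀ (τ j)    ≡⟨ cong₂ _+_ (countF-none (placed (τ j)) notOut) (placed-column j) ⟩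
      countF (λ i → B i j)                    ≡⟨ colDeg j ⟩
      degSeq (J k l) (D J N l) j              ∎
      where
      open ≡-Reasoning
      notOut : ∀ v → placed (τ j) v ≡ false
      notOut v = notTrue (λ arc → k≢l (trans (sym (proj₁ (ends (τ j) v arc))) (proj₁ (proj₂ τ-bij) j)))

    untouched : ∀ u → tdeg u ≢ k → tdeg u ≢ l → deg crossing u ≡ 0
    untouched u u∉k u∉l = countF-none (crossing u) (λ v → cong₂ _∨_
      (notTrue (λ arc → u∉k (proj₁ (ends u v arc)))) (notTrue (λ arc → u∉l (proj₂ (ends v u arc)))))

    balanceX : ∀ u v → tdeg u ≡ tdeg v → deg G u ≤ suc (deg G v) →
      deg G u + deg crossing u ≤ suc (deg G v + deg crossing v)
    balanceX u v same du≤ with tdeg u ≟ k | tdeg u ≟ l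
    ... | yes u∈k | _ =
      classBalance tdeg G crossing k (J k l) (D J N k) σ σ-bij σ-ord degRow u v u∈k (trans (sym same) u∈k) du≤
    ... | no  _   | yes u∈l =
      classBalance tdeg G crossing l (J k l) (D J N l) τ τ-bij τ-ord degColumn u v u∈l (trans (sym same) u∈l) du≤
    ... | no  u∉k | no  u∉l rewrite untouched u u∉k u∉l | untouched v (u∉k ∘ trans same) (u∉l ∘ trans same) =
      subst₂ (λ x y → x ≤ suc y) (sym (+-identityʳ _)) (sym (+-identityʳ _)) du≤

  invariant-offDiagonal : ∀ {processed G G'} k l → k ≢ l → (∀ a b → J a b ≡ J b a) →
    J k l ≤ D J N k * D J N l → Invariant processed G → timesProcessed processed k l ≡ 0 →
    OffDiagStep J N tdeg k l G G' → Invariant (processed ++ (k , l) ∷ []) G'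
  invariant-offDiagonal {processed} {G} k l k≢l J-sym bound I unprocessed st =
    invariant-∪ crossing I G'≡ X-sym X-loopless disjoint arcsX balanceX
    where
    open OffDiagonalArcs k≢l J-sym bound st

    disjoint : Disjoint G crossing
    disjoint u v arc = notTrue (λ new → [ forward , backward ] (∨-true new))
      where
      forward : placed u v ≡ true → ⊥
      forward fwd = noArcYet I unprocessed u v arc (proj₁ (ends u v fwd)) (proj₂ (ends u v fwd))
      backward : placed v u ≡ true → ⊥
      backward bwd = noArcYet I (trans (+-comm (occ processed (l , k)) _) unprocessed) u v arc
                       (proj₂ (ends v u bwd)) (proj₁ (ends v u bwd))

  module DiagonalArcs {G G' : Graph n} {k : ℕ} (bound : J k k ≤ D J N k C 2) (st : DiagStep J N tdeg k G G') where

    open DiagStep st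
    open Placement B σ σ (proj₁ σ-bij) (proj₁ σ-bij) public

    inK : ∀ i → tdeg (σ i) ≡ k
    inK = proj₁ (proj₂ σ-bij)

    ends : ∀ u v → placed u v ≡ true → tdeg u ≡ k × tdeg v ≡ k
    ends u v arc = let (i , j , _ , σi≡u , σj≡v) = placed-elim arc in
      trans (cong tdeg (sym σi≡u)) (inK i) , trans (cong tdeg (sym σj≡v)) (inK j)

    G'≡ : ∀ u v → G' u v ≡ (G ∪ placed) u v
    G'≡ u v = ⇔-∨ (result u v) (placed-spec u v)

    X-sym : ∀ u v → placed u v ≡ placed v u
    X-sym u v = bool-ext (flipped u v) (flipped v u)
      where
      flipped : ∀ u v → placed u v ≡ true → placed v u ≡ true
      flipped u v arc = let (i , j , Bij , σi≡u , σj≡v) = placed-elim arc in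
        placed-intro (j , i , trans (B-sym j i) Bij , σj≡v , σi≡u)

    X-loopless : ∀ u → placed u u ≡ false
    X-loopless u = notTrue (λ loop → let (i , j , Bij , σi≡u , σj≡u) = placed-elim loop in
      true≢false (trans (sym Bij) (subst (λ j → B i j ≡ false) (proj₁ σ-bij (trans σi≡u (sym σj≡u))) (B-irr i))))

    total : sumF (λ u → countF (placed u)) ≡ 2 * J k k
    total = trans placed-total (trans (sumF-cong degB)
      (degSeq-total (2 * J k k) (D J N k)
        (λ Dk≡0 → cong (2 *_) (n≤0⇒n≡0 (≤-trans bound (≤-reflexive (cong (_C 2) Dk≡0)))))))

    arcsX : ArcsOfPair (k , k) placed
    arcsX a b = begin
      arcsBetween placed a b
        ≡⟨ arcsBetween-localised placed k k ends a b ⟩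
      e * sumF (λ u → countF (placed u))
        ≡⟨ cong (e *_) total ⟩
      e * (J k k + (J k k + 0))
        ≡⟨ cong (λ x → e * (J k k + x)) (+-identityʳ (J k k)) ⟩
      e * (J k k + J k k)
        ≡⟨ *-distribˡ-+ e (J k k) (J k k) ⟩
      e * J k k + e * J k k
        ≡⟨ cong (λ x → e * J k k + ⟦ x ⟧ * J k k) mirror ⟩
      e * J k k + ⟦ ⌊ (k , k) ≟ₚ (b , a) ⌋ ⟧ * J k k
        ≡⟨ weighted-pair _ _ (J k k) (J a b) same (λ rev → same (trans mirror rev)) ⟩
      J a b * (e + ⟦ ⌊ (k , k) ≟ₚ (b , a) ⌋ ⟧) ∎
      where
      open ≡-Reasoning
      e : ℕ
      e = ⟦ ⌊ (k , k) ≟ₚ (a , b) ⌋ ⟧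
      same : ⌊ (k , k) ≟ₚ (a , b) ⌋ ≡ true → J a b ≡ J k k
      same e with witness ((k , k) ≟ₚ (a , b)) e
      ... | refl = refl
      mirror : ⌊ (k , k) ≟ₚ (a , b) ⌋ ≡ ⌊ (k , k) ≟ₚ (b , a) ⌋
      mirror = bool-ext (swapped a b) (swapped b a)
        where
        swapped : ∀ a b → ⌊ (k , k) ≟ₚ (a , b) ⌋ ≡ true → ⌊ (k , k) ≟ₚ (b , a) ⌋ ≡ true
        swapped a b e with witness ((k , k) ≟ₚ (a , b)) e
        ... | refl = dec-true ((k , k) ≟ₚ (k , k)) refl

    untouched : ∀ u → tdeg u ≢ k → deg placed u ≡ 0
    untouched u u∉k = countF-none (placed u) (λ v → notTrue (λ arc → u∉k (proj₁ (ends u v arc))))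

    degClass : ∀ i → deg placed (σ i) ≡ degSeq (2 * J k k) (D J N k) i
    degClass i = trans (placed-row i) (degB i)

    balanceX : ∀ u v → tdeg u ≡ tdeg v → deg G u ≤ suc (deg G v) →
      deg G u + deg placed u ≤ suc (deg G v + deg placed v)
    balanceX u v same du≤ with tdeg u ≟ k
    ... | yes u∈k =
      classBalance tdeg G placed k (2 * J k k) (D J N k) σ σ-bij σ-ord degClass u v u∈k (trans (sym same) u∈k) du≤
    ... | no  u∉k rewrite untouched u u∉k | untouched v (u∉k ∘ trans same) =
      subst₂ (λ x y → x ≤ suc y) (sym (+-identityʳ _)) (sym (+-identityʳ _)) du≤

  invariant-diagonal : ∀ {processed G G'} k → J k k ≤ D J N k C 2 → Invariant processed G →
    timesProcessed processed k k ≡ 0 → DiagStep J N tdeg k G G' → Invariant (processed ++ (k , k) ∷ []) G'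
  invariant-diagonal {processed} {G} k bound I unprocessed st =
    invariant-∪ placed I G'≡ X-sym X-loopless disjoint arcsX balanceX
    where
    open DiagonalArcs bound st
    disjoint : Disjoint G placed
    disjoint u v arc = notTrue (λ new → noArcYet I unprocessed u v arc (proj₁ (ends u v new)) (proj₂ (ends u v new)))

  invariant-step : (∀ a b → J a b ≡ J b a) → (∀ k l → k ≢ l → J k l ≤ D J N k * D J N l) →
    (∀ k → J k k ≤ D J N k C 2) →
    ∀ {processed G G'} k l → Invariant processed G → timesProcessed processed k l ≡ 0 →
    Step J N tdeg (k , l) G G' → Invariant (processed ++ (k , l) ∷ []) G'
  invariant-step J-sym offBound diagBound k l I unprocessed st with k ≟ l
  ... | yes refl = invariant-diagonal k (diagBound k) I unprocessed st
  ... | no  k≢l  = invariant-offDiagonal k l k≢l J-sym (offBound k l k≢l) I unprocessed st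

  invariant-run : (∀ a b → J a b ≡ J b a) → (∀ k l → k ≢ l → J k l ≤ D J N k * D J N l) →
    (∀ k → J k k ≤ D J N k C 2) →
    ∀ ps qs {G₀ G} → pairs N ≡ ps ++ qs → Invariant ps G₀ → Run J N tdeg G₀ qs G → Invariant (pairs N) G
  invariant-run _ _ _ ps [] split I done = subst (λ ps → Invariant ps _) (sym (trans split (++-identityʳ ps))) I
  invariant-run J-sym offBound diagBound ps ((k , l) ∷ qs) split I (step st rest) =
    invariant-run J-sym offBound diagBound (ps ++ (k , l) ∷ []) qs (trans split (sym (++-assoc ps ((k , l) ∷ []) qs)))
      (invariant-step J-sym offBound diagBound k l I (proj₂ (fresh N ps qs k l split)) st) rest

sumTo : ℕ → (ℕ → ℕ) → ℕ
sumTo zero    f = 0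
sumTo (suc N) f = sumTo N f + f (suc N)

rowSum-as-sumTo : ∀ J N k → rowSum J N k ≡ sumTo N (J k)
rowSum-as-sumTo J zero    k = refl
rowSum-as-sumTo J (suc N) k = begin
  sum (map (J k) (map suc (upTo (suc N))))
    ≡⟨ cong (λ xs → sum (map (J k) (map suc xs))) (sym (upTo-∷ʳ N)) ⟩
  sum (map (J k) (map suc (upTo N ∷ʳ N)))
    ≡⟨ cong (λ xs → sum (map (J k) xs)) (map-++ suc (upTo N) (N ∷ [])) ⟩
  sum (map (J k) (range1 N ++ suc N ∷ []))
    ≡⟨ cong sum (map-++ (J k) (range1 N) (suc N ∷ [])) ⟩
  sum (map (J k) (range1 N) ++ J k (suc N) ∷ [])
    ≡⟨ sum-++ (map (J k) (range1 N)) (J k (suc N) ∷ []) ⟩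
  rowSum J N k + (J k (suc N) + 0)
    ≡⟨ cong₂ _+_ (rowSum-as-sumTo J N k) (+-identityʳ _) ⟩
  sumTo N (J k) + J k (suc N) ∎
  where open ≡-Reasoning

sumTo-cong : ∀ N {f g} → (∀ b → 1 ≤ b → b ≤ N → f b ≡ g b) → sumTo N f ≡ sumTo N g
sumTo-cong zero    _  = refl
sumTo-cong (suc N) eq = cong₂ _+_ (sumTo-cong N (λ b 1≤b b≤N → eq b 1≤b (m≤n⇒m≤1+n b≤N))) (eq (suc N) (s≤s z≤n) ≤-refl)

sumTo-+ : ∀ N f g → sumTo N (λ b → f b + g b) ≡ sumTo N f + sumTo N g
sumTo-+ zero    f g = refl
sumTo-+ (suc N) f g rewrite sumTo-+ N f g = interchange (sumTo N f) (sumTo N g) (f (suc N)) (g (suc N))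

sumTo-*ˡ : ∀ N c f → sumTo N (λ b → c * f b) ≡ c * sumTo N f
sumTo-*ˡ zero    c f = sym (*-zeroʳ c)
sumTo-*ˡ (suc N) c f rewrite sumTo-*ˡ N c f = sym (*-distribˡ-+ c (sumTo N f) (f (suc N)))

sumTo-zero : ∀ N f → (∀ b → 1 ≤ b → b ≤ N → f b ≡ 0) → sumTo N f ≡ 0
sumTo-zero zero    f _    = refl
sumTo-zero (suc N) f vanish rewrite vanish (suc N) (s≤s z≤n) ≤-refl =
  trans (+-identityʳ _) (sumTo-zero N f (λ b 1≤b b≤N → vanish b 1≤b (m≤n⇒m≤1+n b≤N)))

sumTo-delta : ∀ N t (f : ℕ → ℕ) → 1 ≤ t → t ≤ N → sumTo N (λ b → ⟦ ⌊ t ≟ b ⌋ ⟧ * f b) ≡ f t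
sumTo-delta zero    t f 1≤t t≤0 = ⊥-elim (1+n≰n (≤-trans 1≤t t≤0))
sumTo-delta (suc N) t f 1≤t t≤1+N with t ≟ suc N
... | yes refl = trans (cong (_+ (f (suc N) + 0)) (sumTo-zero N _ (λ b _ b≤N →
                   cong (λ x → ⟦ x ⟧ * f b) (dec-false (suc N ≟ b) (λ 1+N≡b → 1+n≰n (≤-trans (≤-reflexive 1+N≡b) b≤N))))))
                   (+-identityʳ _)
... | no  t≢1+N = trans (+-identityʳ _) (sumTo-delta N t f 1≤t (≤-pred (≤∧≢⇒< t≤1+N t≢1+N)))

sumF-sumTo : ∀ {n} N (g : Fin n → ℕ → ℕ) → sumF (λ u → sumTo N (g u)) ≡ sumTo N (λ b → sumF (λ u → g u b))
sumF-sumTo {n} zero    g = sumF-zero {n} _ (λ _ → refl)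
sumF-sumTo {n} (suc N) g = trans (sumF-+ (λ u → sumTo N (g u)) (λ u → g u (suc N)))
                                 (cong (_+ sumF (λ u → g u (suc N))) (sumF-sumTo N g))

balanced-average : ∀ {n} (P : Fin n → Bool) (f : Fin n → ℕ) k →
  sumF (λ v → ⟦ P v ⟧ * f v) ≡ k * countF P →
  (∀ u v → P u ≡ true → P v ≡ true → f u ≤ suc (f v)) → ∀ u → P u ≡ true → f u ≡ k
balanced-average P f k average near u Pu = byTrichotomy (<-cmp (f u) k)
  where
  open ≤-Reasoning
  atK : sumF (λ v → ⟦ P v ⟧ * k) ≡ k * countF P
  atK = trans (sumF-*ʳ k (λ v → ⟦ P v ⟧)) (trans (cong (_* k) (sym (countF-as-sumF P))) (*-comm (countF P) k))
  onP : ∀ b {x y} → (b ≡ true → x ≤ y) → ⟦ b ⟧ * x ≤ ⟦ b ⟧ * y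
  onP true  x≤y = +-monoˡ-≤ 0 (x≤y refl)
  onP false _   = z≤n
  onP< : ∀ b {x y} → b ≡ true → x < y → ⟦ b ⟧ * x < ⟦ b ⟧ * y
  onP< true _ x<y = +-monoˡ-< 0 x<y
  byTrichotomy : Tri (f u < k) (f u ≡ k) (k < f u) → f u ≡ k
  byTrichotomy (tri≈ _ fu≡k _) = fu≡k
  byTrichotomy (tri< fu<k _ _) = ⊥-elim (<-irrefl average (begin-strict
    sumF (λ v → ⟦ P v ⟧ * f v)
      <⟨ sumF-mono-< (λ v → onP (P v) (λ Pv → ≤-trans (near v u Pv Pu) fu<k)) u (onP< (P u) Pu fu<k) ⟩
    sumF (λ v → ⟦ P v ⟧ * k)   ≡⟨ atK ⟩
    k * countF P               ∎))
  byTrichotomy (tri> _ _ k<fu) = ⊥-elim (<-irrefl (sym average) (begin-strict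
    k * countF P               ≡⟨ sym atK ⟩
    sumF (λ v → ⟦ P v ⟧ * k)
      <⟨ sumF-mono-< (λ v → onP (P v) (λ Pv → ≤-pred (≤-trans k<fu (near u v Pu Pv)))) u (onP< (P u) Pu k<fu) ⟩
    sumF (λ v → ⟦ P v ⟧ * f v) ∎))

ordered-pairs : ∀ {n} (H : Fin n → Fin n → Bool) → (∀ u v → H u v ≡ H v u) → (∀ u → H u u ≡ false) →
  2 * sumF (λ u → countF (λ v → ⌊ toℕ u <? toℕ v ⌋ ∧ H u v)) ≡ sumF (λ u → sumF (λ v → ⟦ H u v ⟧))
ordered-pairs {n} H H-sym H-loopless = begin
  2 * sumF (λ u → countF (λ v → ⌊ toℕ u <? toℕ v ⌋ ∧ H u v))
    ≡⟨ cong (2 *_) (sumF-cong (λ u → countF-as-sumF (λ v → ⌊ toℕ u <? toℕ v ⌋ ∧ H u v))) ⟩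
  2 * sumF (λ u → sumF (upper u))  ≡⟨ cong (sumF (λ u → sumF (upper u)) +_) (+-identityʳ _) ⟩
  sumF (λ u → sumF (upper u)) + sumF (λ u → sumF (upper u))
    ≡⟨ cong (sumF (λ u → sumF (upper u)) +_) upper≡lower ⟩
  sumF (λ u → sumF (upper u)) + sumF (λ u → sumF (lower u))
    ≡⟨ sym (sumF²-+ upper lower) ⟩
  sumF (λ u → sumF (λ v → upper u v + lower u v))
    ≡⟨ sumF²-cong eitherOrder ⟩
  sumF (λ u → sumF (λ v → ⟦ H u v ⟧)) ∎
  where
  open ≡-Reasoning
  upper lower : Fin n → Fin n → ℕ
  upper u v = ⟦ ⌊ toℕ u <? toℕ v ⌋ ∧ H u v ⟧
  lower u v = ⟦ ⌊ toℕ v <? toℕ u ⌋ ∧ H u v ⟧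
  upper≡lower : sumF (λ u → sumF (upper u)) ≡ sumF (λ u → sumF (lower u))
  upper≡lower = trans (sumF-swap upper) (sumF²-cong (λ u v → cong (λ h → ⟦ ⌊ toℕ v <? toℕ u ⌋ ∧ h ⟧) (H-sym v u)))
  eitherOrder : ∀ u v → upper u v + lower u v ≡ ⟦ H u v ⟧
  eitherOrder u v with <-cmp (toℕ u) (toℕ v)
  ... | tri< u<v _ _ rewrite dec-true (toℕ u <? toℕ v) u<v | dec-false (toℕ v <? toℕ u) (<-asym u<v) = +-identityʳ _
  ... | tri> _ _ v<u rewrite dec-false (toℕ u <? toℕ v) (<-asym v<u) | dec-true (toℕ v <? toℕ u) v<u = refl
  ... | tri≈ _ u≡v _ with toℕ-injective u≡v
  ...   | refl rewrite H-loopless u | ∧-zeroʳ ⌊ toℕ u <? toℕ u ⌋ = refl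

module Completion (J : Matrix) (N : ℕ) {n : ℕ} (tdeg : Fin n → ℕ)
  (J-sym : ∀ k l → J k l ≡ J l k)
  (support : ∀ k l → J k l ≢ 0 → 1 ≤ k × k ≤ N)
  (integral : ∀ k → 1 ≤ k → k ∣ (J k k + rowSum J N k))
  (positive : ∀ v → 1 ≤ tdeg v)
  (classSize : ∀ k → 1 ≤ k → countF (inClass tdeg k) ≡ D J N k)
  (G : Graph n) (I : AlgorithmInvariant.Invariant J N tdeg (pairs N) G) where

  open AlgorithmInvariant J N tdeg
  open Invariant I

  -- Every edge of type {a, b} is an arc from a to b, and also from b to a when a = b.
  arcs-final : ∀ a b → arcsBetween G a b ≡ J a b + ⟦ ⌊ a ≟ b ⌋ ⟧ * J a b
  arcs-final a b with J a b ≟ 0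
  ... | yes Jab≡0 rewrite arcCount a b | Jab≡0 = sym (*-zeroʳ ⟦ ⌊ a ≟ b ⌋ ⟧)
  ... | no  Jab≢0 = begin
    arcsBetween G a b                                   ≡⟨ arcCount a b ⟩
    J a b * timesProcessed (pairs N) a b                ≡⟨ cong (J a b *_) (timesProcessed-all N a b 1≤a a≤N 1≤b b≤N) ⟩
    J a b * (1 + ⟦ ⌊ a ≟ b ⌋ ⟧)                         ≡⟨ algebra (J a b) ⟦ ⌊ a ≟ b ⌋ ⟧ ⟩
    J a b + ⟦ ⌊ a ≟ b ⌋ ⟧ * J a b                       ∎
    where
    open ≡-Reasoning
    1≤a : 1 ≤ a
    1≤a = proj₁ (support a b Jab≢0)
    a≤N : a ≤ N
    a≤N = proj₂ (support a b Jab≢0)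
    1≤b : 1 ≤ b
    1≤b = proj₁ (support b a (Jab≢0 ∘ trans (J-sym a b)))
    b≤N : b ≤ N
    b≤N = proj₂ (support b a (Jab≢0 ∘ trans (J-sym a b)))
    algebra : ∀ j e → j * (1 + e) ≡ j + e * j
    algebra = solve-∀

  -- Target degrees lie in 1..N: a class beyond N has D = 0 members.
  target≤N : ∀ v → tdeg v ≤ N
  target≤N v with tdeg v ≤? N
  ... | yes t≤N = t≤N
  ... | no  t≰N = ⊥-elim (1+n≰n (begin
    1                          ≤⟨ countF-pos (inClass tdeg (tdeg v)) v (dec-true (tdeg v ≟ tdeg v) refl) ⟩
    countF (inClass tdeg t)    ≡⟨ classSize t (positive v) ⟩
    D J N t                    ≡⟨ emptyClass t (positive v) (λ b → outside b) ⟩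
    0                          ∎))
    where
    open ≤-Reasoning
    t : ℕ
    t = tdeg v
    outside : ∀ b → J t b ≡ 0
    outside b with J t b ≟ 0
    ... | yes Jtb≡0 = Jtb≡0
    ... | no  Jtb≢0 = ⊥-elim (t≰N (proj₂ (support t b Jtb≢0)))
    emptyClass : ∀ k → 1 ≤ k → (∀ b → J k b ≡ 0) → D J N k ≡ 0
    emptyClass (suc k) _ zeroRow rewrite zeroRow (suc k) | rowSum-as-sumTo J N (suc k)
      | sumTo-zero N (J (suc k)) (λ b _ _ → zeroRow b) = refl

  classDegreeSum : ∀ k → sumF (λ v → ⟦ inClass tdeg k v ⟧ * deg G v) ≡ sumTo N (arcsBetween G k)
  classDegreeSum k = begin
    sumF (λ v → ⟦ inClass tdeg k v ⟧ * deg G v)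
      ≡⟨ sumF-cong perVertex ⟩
    sumF (λ v → sumF (λ u → sumTo N (λ b → ⟦ G v u ∧ inClass tdeg k v ∧ inClass tdeg b u ⟧)))
      ≡⟨ sumF-cong (λ v → sumF-sumTo N (λ u b → ⟦ G v u ∧ inClass tdeg k v ∧ inClass tdeg b u ⟧)) ⟩
    sumF (λ v → sumTo N (λ b → sumF (λ u → ⟦ G v u ∧ inClass tdeg k v ∧ inClass tdeg b u ⟧)))
      ≡⟨ sumF-sumTo N (λ v b → sumF (λ u → ⟦ G v u ∧ inClass tdeg k v ∧ inClass tdeg b u ⟧)) ⟩
    sumTo N (arcsBetween G k) ∎
    where
    open ≡-Reasoning
    oneClass : ∀ u → sumTo N (λ b → ⟦ inClass tdeg b u ⟧) ≡ 1
    oneClass u = trans (sumTo-cong N (λ b _ _ → sym (*-identityʳ _)))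
                       (sumTo-delta N (tdeg u) (λ _ → 1) (positive u) (target≤N u))
    perArc : ∀ v u → ⟦ inClass tdeg k v ⟧ * ⟦ G v u ⟧ ≡
      sumTo N (λ b → ⟦ G v u ∧ inClass tdeg k v ∧ inClass tdeg b u ⟧)
    perArc v u = sym (begin
      sumTo N (λ b → ⟦ G v u ∧ inClass tdeg k v ∧ inClass tdeg b u ⟧)
        ≡⟨ sumTo-cong N (λ b _ _ → trans (⟦∧⟧ (G v u) _) (trans (cong (⟦ G v u ⟧ *_) (⟦∧⟧ (inClass tdeg k v) (inClass tdeg b u)))
                                     (sym (*-assoc ⟦ G v u ⟧ _ _)))) ⟩
      sumTo N (λ b → ⟦ G v u ⟧ * ⟦ inClass tdeg k v ⟧ * ⟦ inClass tdeg b u ⟧)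
        ≡⟨ sumTo-*ˡ N (⟦ G v u ⟧ * ⟦ inClass tdeg k v ⟧) (λ b → ⟦ inClass tdeg b u ⟧) ⟩
      ⟦ G v u ⟧ * ⟦ inClass tdeg k v ⟧ * sumTo N (λ b → ⟦ inClass tdeg b u ⟧)
        ≡⟨ cong (⟦ G v u ⟧ * ⟦ inClass tdeg k v ⟧ *_) (oneClass u) ⟩
      ⟦ G v u ⟧ * ⟦ inClass tdeg k v ⟧ * 1
        ≡⟨ trans (*-identityʳ _) (*-comm ⟦ G v u ⟧ _) ⟩
      ⟦ inClass tdeg k v ⟧ * ⟦ G v u ⟧ ∎)
    perVertex : ∀ v → ⟦ inClass tdeg k v ⟧ * deg G v ≡
      sumF (λ u → sumTo N (λ b → ⟦ G v u ∧ inClass tdeg k v ∧ inClass tdeg b u ⟧))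
    perVertex v = trans (cong (⟦ inClass tdeg k v ⟧ *_) (countF-as-sumF (G v)))
                    (trans (sym (sumF-*ˡ ⟦ inClass tdeg k v ⟧ (λ u → ⟦ G v u ⟧))) (sumF-cong (perArc v)))

  classArcTotal : ∀ k → 1 ≤ k → k ≤ N → sumTo N (arcsBetween G k) ≡ k * countF (inClass tdeg k)
  classArcTotal (suc k) _ k≤N = begin
    sumTo N (arcsBetween G (suc k))
      ≡⟨ sumTo-cong N (λ b _ _ → arcs-final (suc k) b) ⟩
    sumTo N (λ b → J (suc k) b + ⟦ ⌊ suc k ≟ b ⌋ ⟧ * J (suc k) b)
      ≡⟨ sumTo-+ N (J (suc k)) (λ b → ⟦ ⌊ suc k ≟ b ⌋ ⟧ * J (suc k) b) ⟩
    sumTo N (J (suc k)) + sumTo N (λ b → ⟦ ⌊ suc k ≟ b ⌋ ⟧ * J (suc k) b)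
      ≡⟨ cong₂ _+_ (sym (rowSum-as-sumTo J N (suc k))) (sumTo-delta N (suc k) (J (suc k)) (s≤s z≤n) k≤N) ⟩
    rowSum J N (suc k) + J (suc k) (suc k)
      ≡⟨ +-comm (rowSum J N (suc k)) _ ⟩
    J (suc k) (suc k) + rowSum J N (suc k)
      ≡⟨ sym (m*[n/m]≡n (integral (suc k) (s≤s z≤n))) ⟩
    suc k * D J N (suc k)
      ≡⟨ cong (suc k *_) (sym (classSize (suc k) (s≤s z≤n))) ⟩
    suc k * countF (inClass tdeg (suc k)) ∎
    where open ≡-Reasoning

  -- Balanced degrees with the right average: every vertex has its target degree.
  degrees-correct : ∀ v → deg G v ≡ tdeg v
  degrees-correct v = balanced-average (inClass tdeg (tdeg v)) (deg G) (tdeg v)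
    (trans (classDegreeSum (tdeg v)) (classArcTotal (tdeg v) (positive v) (target≤N v)))
    (λ u w u∈ w∈ → balanced u w (trans (witness (tdeg u ≟ tdeg v) u∈) (sym (witness (tdeg w ≟ tdeg v) w∈))))
    v (dec-true (tdeg v ≟ tdeg v) refl)

  jointDegrees-correct : ∀ k l → JG G k l ≡ J k l
  jointDegrees-correct k l = *-cancelˡ-≡ (JG G k l) (J k l) 2 (begin
    2 * JG G k l                                      ≡⟨ cong (2 *_) byTargets ⟩
    2 * sumF (λ u → countF (λ v → ⌊ toℕ u <? toℕ v ⌋ ∧ H u v)) ≡⟨ ordered-pairs H H-sym H-loopless ⟩
    sumF (λ u → sumF (λ v → ⟦ H u v ⟧))               ≡⟨ arcsOfType ⟩
    2 * J k l                                         ∎)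
    where
    open ≡-Reasoning
    H : Fin n → Fin n → Bool
    H u v = G u v ∧ (between k l u v ∨ between l k u v)
    byTargets : JG G k l ≡ sumF (λ u → countF (λ v → ⌊ toℕ u <? toℕ v ⌋ ∧ H u v))
    byTargets = sumF-cong (λ u → countF-cong (λ v → cong₂
      (λ x y → ⌊ toℕ u <? toℕ v ⌋ ∧ G u v ∧ ((⌊ x ≟ k ⌋ ∧ ⌊ y ≟ l ⌋) ∨ (⌊ x ≟ l ⌋ ∧ ⌊ y ≟ k ⌋)))
      (degrees-correct u) (degrees-correct v)))
    H-sym : ∀ u v → H u v ≡ H v u
    H-sym u v = cong₂ _∧_ (symmetric u v) (trans (∨-comm (between k l u v) _)
      (cong₂ _∨_ (∧-comm (inClass tdeg l u) _) (∧-comm (inClass tdeg k u) _)))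
    H-loopless : ∀ u → H u u ≡ false
    H-loopless u rewrite loopless u = refl
    arcsOfType : sumF (λ u → sumF (λ v → ⟦ H u v ⟧)) ≡ 2 * J k l
    arcsOfType with k ≟ l
    ... | yes refl = begin
      sumF (λ u → sumF (λ v → ⟦ H u v ⟧))
        ≡⟨ sumF²-cong (λ u v → cong (λ c → ⟦ G u v ∧ c ⟧) (∨-idem (between k k u v))) ⟩
      arcsBetween G k k                ≡⟨ arcs-final k k ⟩
      J k k + ⟦ ⌊ k ≟ k ⌋ ⟧ * J k k    ≡⟨ cong (λ b → J k k + ⟦ b ⟧ * J k k) (dec-true (k ≟ k) refl) ⟩
      J k k + (J k k + 0)              ∎
    ... | no  k≢l = begin
      sumF (λ u → sumF (λ v → ⟦ H u v ⟧))
        ≡⟨ sumF²-cong eitherOrientation ⟩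
      sumF (λ u → sumF (λ v → ⟦ G u v ∧ between k l u v ⟧ + ⟦ G u v ∧ between l k u v ⟧))
        ≡⟨ sumF²-+ (λ u v → ⟦ G u v ∧ between k l u v ⟧) (λ u v → ⟦ G u v ∧ between l k u v ⟧) ⟩
      arcsBetween G k l + arcsBetween G l k
        ≡⟨ cong₂ _+_ (arcs-final k l) (arcs-final l k) ⟩
      J k l + ⟦ ⌊ k ≟ l ⌋ ⟧ * J k l + (J l k + ⟦ ⌊ l ≟ k ⌋ ⟧ * J l k)
        ≡⟨ cong₂ (λ x y → J k l + ⟦ x ⟧ * J k l + (J l k + ⟦ y ⟧ * J l k))
                 (dec-false (k ≟ l) k≢l) (dec-false (l ≟ k) (k≢l ∘ sym)) ⟩
      J k l + 0 + (J l k + 0)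
        ≡⟨ cong₂ _+_ (+-identityʳ (J k l)) (trans (+-identityʳ (J l k)) (sym (J-sym k l))) ⟩
      J k l + J k l
        ≡⟨ cong (J k l +_) (sym (+-identityʳ (J k l))) ⟩
      2 * J k l ∎
      where
      eitherOrientation : ∀ u v → ⟦ H u v ⟧ ≡ ⟦ G u v ∧ between k l u v ⟧ + ⟦ G u v ∧ between l k u v ⟧
      eitherOrientation u v with G u v
      ... | false = refl
      ... | true  = ⟦∨⟧ (between k l u v) (between l k u v) (λ kl → notTrue (λ lk → k≢l (trans
                      (sym (witness (tdeg u ≟ k) (proj₁ (∧-true kl)))) (witness (tdeg u ≟ l) (proj₁ (∧-true lk))))))

mainTheorem2 : (J : Matrix) (N : ℕ) →
    (∀ k l → J k l ≡ J l k) →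
    (∀ k l → J k l ≢ 0 → 1 ≤ k × k ≤ N) →
    (∀ k → 1 ≤ k → k ∣ (J k k + rowSum J N k)) →
    (∀ k l → k ≢ l → J k l ≤ D J N k * D J N l) →
    (∀ k → J k k ≤ D J N k C 2) →
    (n : ℕ) (tdeg : Fin n → ℕ) →
    (∀ v → 1 ≤ tdeg v) →
    (∀ k → 1 ≤ k → countF (λ v → ⌊ tdeg v ≟ k ⌋) ≡ D J N k) →
    ((ps qs : List (ℕ × ℕ)) (p : ℕ × ℕ) (G : Graph n) →
       pairs N ≡ ps ++ (p ∷ qs) → Run J N tdeg emptyGraph ps G →
       ∃ λ G' → Step J N tdeg p G G')
    ×
    ((G : Graph n) → Run J N tdeg emptyGraph (pairs N) G →
       Simple G × (∀ k l → JG G k l ≡ J k l))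
mainTheorem2 J N J-sym support integral offBound diagBound n tdeg positive classSize =
  canContinue , correctOutcome
  where
  -- Each pair reached is scheduled, so 1 ≤ l ≤ k, and its step can be performed.
  canContinue : (ps qs : List (ℕ × ℕ)) (p : ℕ × ℕ) (G : Graph n) →
    pairs N ≡ ps ++ (p ∷ qs) → Run J N tdeg emptyGraph ps G → ∃ λ G' → Step J N tdeg p G G'
  canContinue ps qs (k , l) G split _ with fresh N ps qs k l split
  ... | (1≤l , l≤k , _) , _ =
    stepExists J N tdeg offBound diagBound classSize k l (≤-trans 1≤l l≤k) 1≤l G
  correctOutcome : (G : Graph n) → Run J N tdeg emptyGraph (pairs N) G → Simple G × (∀ k l → JG G k l ≡ J k l)
  correctOutcome G run = (symmetric , loopless) , jointDegrees-correct
    where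
    open AlgorithmInvariant J N tdeg using (Invariant; invariant-run; invariant-empty)
    final : Invariant (pairs N) G
    final = invariant-run J-sym offBound diagBound [] (pairs N) refl invariant-empty run
    open Invariant final using (symmetric; loopless)
    open Completion J N tdeg J-sym support integral positive classSize G final using (jointDegrees-correct)
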